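{- Let $\lambda\vdash n$ and let $\widehat{S^\lambda}$ be the Specht module $S^\lambda$ (basis $\{e_T:T\in\mathrm{SYT}(\lambda)\}$) with the $\mathcal{H}_n(0)$-action given on basis elements by: $\overline{\pi}_ie_T=0$ if $i,i+1$ lie in the same row of $T$; $\overline{\pi}_ie_T=-e_T$ if $i$ lies directly below or strictly southeast of $i+1$ in $T$; $\overline{\pi}_ie_T=e_{s_iT}$ if $i$ lies strictly northwest of $i+1$ in $T$. Then $F^Q_{char}(\widehat{S^\lambda})=s_\lambda=F_{char}(S^\lambda)$.
   Context: Tableaux are in French notation (bottom row longest; "north/south" = higher/lower row, "west/east" = left/right). Standard Young tableaux of shape $\lambda$ are fillings by $1,\dots,n$ increasing along rows and up columns; $s_iT$ swaps entries $i,i+1$; $e_T=\sum_\sigma \mathrm{sgn}(\sigma)\{\sigma T\}$ over column-preserving permutations $\sigma$, $\{\cdot\}$ denoting tabloids; $s_\lambda$ is the Schur function. $\mathcal{H}_n(0)$ is generated by $\overline{\pi}_1,\dots,\overline{\pi}_{n-1}$ with $\overline{\pi}_i^2=-\overline{\pi}_i$, $\overline{\pi}_i\overline{\pi}_j=\overline{\pi}_j\overline{\pi}_i$ ($|i-j|\ge2$), $\overline{\pi}_i\overline{\pi}_{i+1}\overline{\pi}_i=\overline{\pi}_{i+1}\overline{\pi}_i\overline{\pi}_{i+1}$ (the action above satisfies these). For $I\subseteq[n-1]$, $C_I$ is the one-dimensional module where $\overline{\pi}_i$ acts by $-1$ if $i\in I$ and $0$ otherwise. For a finite-dimensional $\mathcal{H}_n(0)$-module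 $N$ with composition factors $C_{I_1},\dots,C_{I_m}$ (with multiplicity), $F^Q_{char}(N)=\sum_jF_{I_j}$, where $F_I=\sum x_{i_1}\cdots x_{i_n}$ over $1\le i_1\le\cdots\le i_n$ with $i_j<i_{j+1}$ for $j\in I$. $F_{char}$ is the usual Frobenius characteristic of $\mathfrak{S}_n$-modules, sending the Specht module $S^\mu$ to $s_\mu$. -}

module Defs where

open import Data.Nat using (ℕ; zero; suc; _≤_; _<_; _≡ᵇ_; _<ᵇ_; _≤ᵇ_)
import Data.Nat as ℕ
open import Data.Bool using (Bool; true; false; if_then_else_; _∧_)
open import Data.List using (List; []; _∷_; [_]; map; concatMap; take; drop; length;
  filterᵇ; lookup; allFin; zipWith; upTo; applyUpTo)
open import Data.List.Properties using (≡-dec)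
open import Data.Nat.ListAction using (sum)
open import Data.Bool.ListAction using (and)
open import Data.List.Relation.Unary.All using (All)
open import Data.List.Relation.Unary.Linked using (Linked)
open import Data.Maybe using (Maybe; just; nothing)
import Data.Maybe as Maybe
open import Data.Product using (Σ; _×_; _,_; Σ-syntax)
open import Data.Fin using (Fin; toℕ)
open import Data.Rational using (ℚ; 0ℚ; 1ℚ; _+_; _*_; -_)
open import Relation.Nullary.Decidable using (isYes)
open import Relation.Binary.PropositionalEquality using (_≡_)

IsPartition : ℕ → List ℕ → Set
IsPartition n la = All (λ p → 1 ≤ p) la × Linked (λ a b → b ≤ a) la × sum la ≡ n

-- Fillings in French notation: a list of rows, the head is the BOTTOM
-- (longest) row; each row is listed from west to east.

Filling : Set
Filling = List (List ℕ)

fillShape : List ℕ → List ℕ → Filling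
fillShape []       w = []
fillShape (r ∷ rs) w = take r w ∷ fillShape rs (drop r w)

allWords : ℕ → ℕ → List (List ℕ)
allWords zero    N = [ [] ]
allWords (suc n) N = concatMap (λ w → map (λ a → a ∷ w) (applyUpTo suc N)) (allWords n N)

insertEverywhere : ℕ → List ℕ → List (List ℕ)
insertEverywhere x []       = [ x ∷ [] ]
insertEverywhere x (y ∷ ys) = (x ∷ y ∷ ys) ∷ map (y ∷_) (insertEverywhere x ys)

perms : List ℕ → List (List ℕ)
perms []       = [ [] ]
perms (x ∷ xs) = concatMap (insertEverywhere x) (perms xs)

adjacentAll : (ℕ → ℕ → Bool) → List ℕ → Bool
adjacentAll rel []           = true
adjacentAll rel (a ∷ [])     = true
adjacentAll rel (a ∷ b ∷ xs) = rel a b ∧ adjacentAll rel (b ∷ xs)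

columnsStrict : Filling → Bool
columnsStrict []            = true
columnsStrict (r ∷ [])      = true
columnsStrict (r ∷ r' ∷ rs) = and (zipWith _<ᵇ_ r r') ∧ columnsStrict (r' ∷ rs)

rowsOK : (ℕ → ℕ → Bool) → Filling → Bool
rowsOK rel T = and (map (adjacentAll rel) T)

isStandard : Filling → Bool
isStandard T = rowsOK _<ᵇ_ T ∧ columnsStrict T

isSemistandard : Filling → Bool
isSemistandard T = rowsOK _≤ᵇ_ T ∧ columnsStrict T

sytList : ℕ → List ℕ → List Filling
sytList n la = filterᵇ isStandard (map (fillShape la) (perms (applyUpTo suc n)))

-- Positions (row, column), rows counted from the bottom, columns from the west

colOf : ℕ → List ℕ → Maybe ℕ
colOf x []       = nothing
colOf x (y ∷ ys) = if x ≡ᵇ y then just 0 else Maybe.map suc (colOf x ys)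

posOf : ℕ → Filling → Maybe (ℕ × ℕ)
posOf x []       = nothing
posOf x (r ∷ rs) with colOf x r
... | just c  = just (0 , c)
... | nothing = Maybe.map (λ { (a , b) → (suc a , b) }) (posOf x rs)

swapEntries : ℕ → Filling → Filling
swapEntries i = map (map sw)
  where
  sw : ℕ → ℕ
  sw x = if x ≡ᵇ i then suc i else (if x ≡ᵇ suc i then i else x)

data ActCase : Set where
  sameRow       : ActCase
  belowOrSE     : ActCase
  northwest     : ActCase
  otherPosition : ActCase   -- does not occur for standard T

actCase : ℕ → Filling → ActCase
actCase i T with posOf i T | posOf (suc i) T
... | just (r₁ , c₁) | just (r₂ , c₂) =
  if r₁ ≡ᵇ r₂ then sameRow
  else if (r₁ <ᵇ r₂) ∧ (c₂ ≤ᵇ c₁) then belowOrSE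
  else if (r₂ <ᵇ r₁) ∧ (c₁ <ᵇ c₂) then northwest
  else otherPosition
... | _ | _ = otherPosition

-- The module Ŝ^λ: ℚ-vector space with basis e_T, T ∈ SYT(λ),
-- indexed by Fin (dimS n la); vectors are coordinate functions.

dimS : ℕ → List ℕ → ℕ
dimS n la = length (sytList n la)

Vec : ℕ → Set
Vec D = Fin D → ℚ

∑ : ∀ {D} → (Fin D → ℚ) → ℚ
∑ {zero}  f = 0ℚ
∑ {suc D} f = f Fin.zero + ∑ (λ j → f (Fin.suc j))
  where import Data.Fin as Fin

module Specht (n : ℕ) (la : List ℕ) where

  D : ℕ
  D = dimS n la

  tab : Fin D → Filling
  tab = lookup (sytList n la)

  _≟F_ = ≡-dec (≡-dec ℕ._≟_)

  basis : Fin D → Vec D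
  basis k j = if isYes (Data.Fin._≟_ j k) then 1ℚ else 0ℚ
    where import Data.Fin

  -- e_S for a filling S (zero vector if S is not a standard tableau of shape λ)
  indicator : Filling → Vec D
  indicator S j = if isYes (tab j ≟F S) then 1ℚ else 0ℚ

  πbasis : ℕ → Fin D → Vec D
  πbasis i k with actCase i (tab k)
  ... | sameRow       = λ _ → 0ℚ
  ... | belowOrSE     = λ j → - basis k j
  ... | northwest     = indicator (swapEntries i (tab k))
  ... | otherPosition = λ _ → 0ℚ

  πact : ℕ → Vec D → Vec D
  πact i w j = ∑ (λ k → w k * πbasis i k j)

  InSpanBelow : (Fin D → Vec D) → Fin D → Vec D → Set
  InSpanBelow v k u = Σ[ c ∈ (Fin D → ℚ) ]
    ((∀ j → toℕ k ≤ toℕ j → c j ≡ 0ℚ) × (∀ t → u t ≡ ∑ (λ j → c j * v j t)))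

  IsBasis : (Fin D → Vec D) → Set
  IsBasis v = (∀ (c : Fin D → ℚ) → (∀ t → ∑ (λ j → c j * v j t) ≡ 0ℚ) → ∀ j → c j ≡ 0ℚ)
            × (∀ (u : Vec D) → Σ[ c ∈ (Fin D → ℚ) ] (∀ t → u t ≡ ∑ (λ j → c j * v j t)))

  -- A composition series 0 = N_0 ⊂ N_1 ⊂ … ⊂ N_D = Ŝ^λ, N_k = span(v_0..v_{k-1}),
  -- with N_{k+1}/N_k ≅ C_{I_k}: π̄_i v_k ≡ -[i ∈ I_k] v_k  (mod N_k), 1 ≤ i ≤ n-1.
  record CompositionSeries : Set where
    field
      v       : Fin D → Vec D
      I       : Fin D → ℕ → Bool
      isBasis : IsBasis v
      factor  : ∀ k i → 1 ≤ i → i < n →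
                InSpanBelow v k (λ t → πact i (v k) t + (if I k i then v k t else 0ℚ))

-- Coefficients of monomials x^α, α = (α_1,…,α_N) ∈ ℕ^N (variables x_1..x_N)

count : ℕ → List ℕ → ℕ
count x []       = 0
count x (y ∷ ys) = (if x ≡ᵇ y then 1 else 0) ℕ.+ count x ys

hasContent : List ℕ → List ℕ → Bool
hasContent α w = isYes (≡-dec ℕ._≟_ (map (λ m → count m w) (applyUpTo suc (length α))) α)

-- w_j < w_{j+1} for all j ∈ I (positions 1-indexed)
strictAt : (ℕ → Bool) → ℕ → List ℕ → Bool
strictAt I j []           = true
strictAt I j (a ∷ [])     = true
strictAt I j (a ∷ b ∷ xs) = (if I j then a <ᵇ b else true) ∧ strictAt I (suc j) (b ∷ xs)

-- coefficient of x^α in F_I (degree n): number of i_1 ≤ … ≤ i_n with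
-- i_j < i_{j+1} for j ∈ I and x_{i_1}⋯x_{i_n} = x^α
coefF : ℕ → (ℕ → Bool) → List ℕ → ℕ
coefF n I α = length (filterᵇ (λ w → adjacentAll _≤ᵇ_ w ∧ strictAt I 1 w ∧ hasContent α w)
                              (allWords n (length α)))

-- coefficient of x^α in s_λ: number of SSYT of shape λ with content α
coefSchur : List ℕ → List ℕ → ℕ
coefSchur la α = length (filterᵇ (λ T → isSemistandard T ∧ hasContent α (Data.List.concat T))
                                 (map (fillShape la) (allWords (sum la) (length α))))
  where import Data.List

-- coefficient of x^α in F^Q_char = Σ_k F_{I_k}
coefFQchar : (n : ℕ) (la : List ℕ) → Specht.CompositionSeries n la → List ℕ → ℕ
coefFQchar n la cs α = sum (map (λ k → coefF n (CompositionSeries.I cs k) α) (allFin (Specht.D n la)))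
  where open Specht n la

-- Order the basis e_T by decreasing row weight Σₓ x · row_T(x). In the northwest case π̄ᵢ e_T = e_{sᵢT},
-- and swapping i with the lower entry i+1 raises the row weight, so every π̄ᵢ is triangular: the spans
-- of initial segments form a composition series whose factors are the C_{Des T}, where Des T is the
-- set of i with π̄ᵢ e_T = −e_T. Hence F^Q_char = Σ_T F_{Des T}, and this is s_λ by Gessel's expansion:
-- a standard T with a weakly increasing word w that rises strictly at Des T yields the semistandard
-- tableau obtained by replacing each entry t with the t-th letter of w; standardisation, paired with
-- the sorted content, inverts this.
module Submission where

open import Defs
open import Data.Nat using (ℕ; zero; suc; _≤_; _<_; _≡ᵇ_; _<ᵇ_; _≤ᵇ_; z≤n; s≤s; _+_; _∸_)
open import Data.Nat.Properties
open import Data.Nat.ListAction using (sum)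
open import Data.Nat.ListAction.Properties using (sum-↭)
open import Data.Bool using (Bool; true; false; if_then_else_; _∧_; _∨_; T?)
open import Data.Bool.Properties using (T-≡)
open import Data.Bool.ListAction using (and)
open import Data.Maybe using (Maybe; just; nothing)
import Data.Maybe as Maybe
open import Data.Maybe.Properties using (just-injective)
open import Data.Product using (Σ; Σ-syntax; _×_; _,_; proj₁; proj₂)
open import Data.Sum using (_⊎_; inj₁; inj₂)
open import Data.Empty using (⊥-elim)
open import Data.Fin as Fin using (Fin; toℕ)
import Data.Fin.Properties as Fin
open import Data.Fin.Permutation
  using (Permutation′; _⟨$⟩ʳ_; _⟨$⟩ˡ_; inverseˡ; inverseʳ; insert; insert-punchIn) renaming (id to idₚ)
open import Data.List using (List; []; _∷_; [_]; map; concat; concatMap; length; filterᵇ; _++_;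
  take; drop; applyUpTo; zipWith; cartesianProduct; allFin; _∷ʳ_)
open import Data.List.Properties
open import Data.List.Membership.Propositional using (_∈_; _∉_; find; lose)
open import Data.List.Membership.Propositional.Properties
open import Data.List.Membership.Propositional.Properties.WithK using (unique∧set⇒bag)
open import Data.List.Relation.Unary.Any using (here; there)
open import Data.List.Relation.Unary.All using (All; []; _∷_)
import Data.List.Relation.Unary.All as All
open import Data.List.Relation.Unary.AllPairs using ([]; _∷_)
open import Data.List.Relation.Unary.Linked using (Linked; []; [-]; _∷_)
open import Data.List.Relation.Unary.Unique.Propositional using (Unique)
import Data.List.Relation.Unary.Unique.Propositional.Properties as Unique
open import Data.List.Relation.Unary.Unique.Propositional.Properties using (Unique[x∷xs]⇒x∉xs)
open import Data.List.Relation.Binary.Permutation.Propositional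
  using (_↭_; ↭-sym; ↭-trans; ↭-prep; ↭-swap; ↭-refl; ↭-reflexive; ↭⇒↭ₛ; module PermutationReasoning)
open import Data.List.Relation.Binary.Permutation.Propositional.Properties
  using (↭-length; ∈-resp-↭; shift; drop-mid; map⁺; ↭-empty-inv; ∷↭∷ʳ; filter-↭)
open import Data.List.Relation.Binary.Permutation.Setoid.Properties using ()
  renaming (Unique-resp-↭ to Unique-resp-↭ₛ)
open import Data.List.Relation.Binary.BagAndSetEquality using (∼bag⇒↭)
open import Data.List.Relation.Binary.Pointwise using (Pointwise-≡⇒≡)
open import Data.List.Relation.Unary.Sorted.TotalOrder.Properties using (↗↭↗⇒≋)
import Data.List.Sort as Sort
import Data.Rational as ℚ
import Data.Rational.Properties as ℚ
open import Algebra.Properties.CommutativeSemigroup +-commutativeSemigroup using (interchange)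
open import Function.Base using (_∘_)
open import Function.Bundles using (mk⇔; Equivalence)
open import Relation.Nullary using (¬_; yes; no)
open import Relation.Nullary.Decidable using (isYes)
open import Relation.Binary using (tri<; tri≈; tri>)
open import Relation.Binary.PropositionalEquality hiding ([_])

∧-true⁻ˡ : ∀ {a b} → a ∧ b ≡ true → a ≡ true
∧-true⁻ˡ {true} _ = refl

∧-true⁻ʳ : ∀ {a b} → a ∧ b ≡ true → b ≡ true
∧-true⁻ʳ {true} e = e

∧-true⁺ : ∀ {a b} → a ≡ true → b ≡ true → a ∧ b ≡ true
∧-true⁺ refl refl = refl

<ᵇ-true⇒< : ∀ {x y} → (x <ᵇ y) ≡ true → x < y
<ᵇ-true⇒< {x} {y} = <ᵇ⇒< x y ∘ Equivalence.from T-≡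

<⇒<ᵇ-true : ∀ {x y} → x < y → (x <ᵇ y) ≡ true
<⇒<ᵇ-true = Equivalence.to T-≡ ∘ <⇒<ᵇ

≤ᵇ-true⇒≤ : ∀ {x y} → (x ≤ᵇ y) ≡ true → x ≤ y
≤ᵇ-true⇒≤ {x} {y} = ≤ᵇ⇒≤ x y ∘ Equivalence.from T-≡

≤⇒≤ᵇ-true : ∀ {x y} → x ≤ y → (x ≤ᵇ y) ≡ true
≤⇒≤ᵇ-true = Equivalence.to T-≡ ∘ ≤⇒≤ᵇ

≡ᵇ-true⇒≡ : ∀ {x y} → (x ≡ᵇ y) ≡ true → x ≡ y
≡ᵇ-true⇒≡ {x} {y} = ≡ᵇ⇒≡ x y ∘ Equivalence.from T-≡

≡⇒≡ᵇ-true : ∀ {x y} → x ≡ y → (x ≡ᵇ y) ≡ true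
≡⇒≡ᵇ-true {x} {y} = Equivalence.to T-≡ ∘ ≡⇒≡ᵇ x y

≤⇒<ᵇ-false : ∀ {x y} → y ≤ x → (x <ᵇ y) ≡ false
≤⇒<ᵇ-false {x} {y} y≤x with x <ᵇ y in e
... | true = ⊥-elim (<⇒≱ (<ᵇ-true⇒< e) y≤x)
... | false = refl

<⇒≤ᵇ-false : ∀ {x y} → y < x → (x ≤ᵇ y) ≡ false
<⇒≤ᵇ-false {x} {y} y<x with x ≤ᵇ y in e
... | true = ⊥-elim (<⇒≱ y<x (≤ᵇ-true⇒≤ e))
... | false = refl

true≢false : true ≢ false
true≢false ()

≢⇒≡ᵇ-false : ∀ {x y} → x ≢ y → (x ≡ᵇ y) ≡ false
≢⇒≡ᵇ-false {x} {y} x≢y with x ≡ᵇ y in eq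
... | true = ⊥-elim (x≢y (≡ᵇ-true⇒≡ eq))
... | false = refl

∈-filterᵇ⁻ : ∀ {X : Set} {p : X → Bool} {x : X} xs → x ∈ filterᵇ p xs → x ∈ xs × p x ≡ true
∈-filterᵇ⁻ {p = p} xs m with ∈-filter⁻ (T? ∘ p) {xs = xs} m
... | x∈xs , px = x∈xs , Equivalence.to T-≡ px

∈-filterᵇ⁺ : ∀ {X : Set} {p : X → Bool} {x : X} {xs} → x ∈ xs → p x ≡ true → x ∈ filterᵇ p xs
∈-filterᵇ⁺ {p = p} m px = ∈-filter⁺ (T? ∘ p) m (Equivalence.from T-≡ px)

Unique-filterᵇ : ∀ {X : Set} (p : X → Bool) {xs : List X} → Unique xs → Unique (filterᵇ p xs)
Unique-filterᵇ p = Unique.filter⁺ (T? ∘ p)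

Unique-length-≡ : ∀ {X : Set} {xs ys : List X} → Unique xs → Unique ys →
  (∀ {z} → z ∈ xs → z ∈ ys) → (∀ {z} → z ∈ ys → z ∈ xs) → length xs ≡ length ys
Unique-length-≡ ux uy f g = ↭-length (∼bag⇒↭ (unique∧set⇒bag ux uy (mk⇔ f g)))

length-filterᵇ-bijection : ∀ {X Y : Set} (A : List X) (B : List Y) (p : X → Bool) (q : Y → Bool)
  (f : X → Y) (g : Y → X) → Unique A → Unique B →
  (∀ x → x ∈ A → p x ≡ true → f x ∈ B × q (f x) ≡ true × g (f x) ≡ x) →
  (∀ y → y ∈ B → q y ≡ true → g y ∈ A × p (g y) ≡ true × f (g y) ≡ y) →
  length (filterᵇ p A) ≡ length (filterᵇ q B)
length-filterᵇ-bijection A B p q f g uA uB f-ok g-ok =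
  trans (sym (length-map f A′)) (Unique-length-≡ unique-fA′ (Unique-filterᵇ q uB) to from)
  where
  A′ = filterᵇ p A
  gf≡id : map g (map f A′) ≡ A′
  gf≡id = trans (sym (map-∘ A′)) (map-id-local (All.tabulate λ {x} m →
    let (x∈A , px) = ∈-filterᵇ⁻ A m in proj₂ (proj₂ (f-ok x x∈A px))))
  unique-fA′ : Unique (map f A′)
  unique-fA′ = Unique.map⁻ (subst Unique (sym gf≡id) (Unique-filterᵇ p uA))
  to : ∀ {z} → z ∈ map f A′ → z ∈ filterᵇ q B
  to m with ∈-map⁻ f m
  ... | x , x∈A′ , refl =
    let (x∈A , px) = ∈-filterᵇ⁻ A x∈A′ ; (fx∈B , qfx , _) = f-ok x x∈A px in ∈-filterᵇ⁺ fx∈B qfx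
  from : ∀ {z} → z ∈ filterᵇ q B → z ∈ map f A′
  from {z} m =
    let (z∈B , qz) = ∈-filterᵇ⁻ B m ; (gz∈A , pgz , fgz≡z) = g-ok z z∈B qz in
    subst (_∈ map f A′) fgz≡z (∈-map⁺ f (∈-filterᵇ⁺ gz∈A pgz))

Unique-concatMap : ∀ {X Y : Set} (F : X → List Y) (xs : List X) → Unique xs →
  (∀ x → x ∈ xs → Unique (F x)) →
  (∀ x y z → x ∈ xs → y ∈ xs → z ∈ F x → z ∈ F y → x ≡ y) → Unique (concatMap F xs)
Unique-concatMap F [] u uF disjoint = []
Unique-concatMap F (x ∷ xs) (x∉xs ∷ u) uF disjoint =
  Unique.++⁺ (uF x (here refl))
    (Unique-concatMap F xs u (λ y m → uF y (there m)) (λ a b z ma mb → disjoint a b z (there ma) (there mb)))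
    Fx-disjoint
  where
  Fx-disjoint : ∀ {z} → ¬ (z ∈ F x × z ∈ concatMap F xs)
  Fx-disjoint {z} (z∈Fx , z∈rest) with find (∈-concatMap⁻ F {xs = xs} z∈rest)
  ... | y , y∈xs , z∈Fy = All.lookup x∉xs y∈xs (disjoint x y z (here refl) (there y∈xs) z∈Fx z∈Fy)

Unique-++⁻ : ∀ {X : Set} (R Q : List X) → Unique (R ++ Q) → Unique R × Unique Q × (∀ {x} → x ∈ R → x ∉ Q)
Unique-++⁻ [] Q u = [] , u , λ ()
Unique-++⁻ (y ∷ R) Q (y∉ ∷ u) with Unique-++⁻ R Q u
... | uR , uQ , disjoint = All.tabulate (λ m → All.lookup y∉ (∈-++⁺ˡ m)) ∷ uR , uQ , disjoint′
  where
  disjoint′ : ∀ {x} → x ∈ y ∷ R → x ∉ Q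
  disjoint′ (here refl) x∈Q = All.lookup y∉ (∈-++⁺ʳ R x∈Q) refl
  disjoint′ (there x∈R) x∈Q = disjoint x∈R x∈Q

Unique-middle : ∀ {X : Set} (l r : List X) k → Unique (l ++ k ∷ r) → Unique (l ++ r) × (k ∉ l ++ r)
Unique-middle [] r k (k∉ ∷ u) = u , λ m → All.lookup k∉ m refl
Unique-middle (y ∷ l) r k (y∉ ∷ u) with Unique-middle l r k u
... | u′ , k∉ = All.tabulate (λ m → All.lookup y∉ (skip-k m)) ∷ u′ , k∉′
  where
  skip-k : ∀ {z} → z ∈ l ++ r → z ∈ l ++ k ∷ r
  skip-k m with ∈-++⁻ l m
  ... | inj₁ m₁ = ∈-++⁺ˡ m₁
  ... | inj₂ m₂ = ∈-++⁺ʳ l (there m₂)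
  k∉′ : k ∉ y ∷ l ++ r
  k∉′ (here refl) = All.lookup y∉ (∈-++⁺ʳ l (here refl)) refl
  k∉′ (there m) = k∉ m

Unique-resp-↭ : ∀ {X : Set} {u v : List X} → u ↭ v → Unique v → Unique u
Unique-resp-↭ {X} p = Unique-resp-↭ₛ (setoid X) (↭⇒↭ₛ (↭-sym p))

map-just⁻ : ∀ {X : Set} (f : X → ℕ) (m : Maybe X) {a} → Maybe.map f m ≡ just a → Σ X λ x → m ≡ just x × f x ≡ a
map-just⁻ f (just x) refl = x , refl , refl

countᵇ : ∀ {X : Set} → (X → Bool) → List X → ℕ
countᵇ p K = length (filterᵇ p K)

countᵇ-∷ : ∀ {X : Set} (p : X → Bool) x K → countᵇ p (x ∷ K) ≡ (if p x then suc (countᵇ p K) else countᵇ p K)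
countᵇ-∷ p x K with p x
... | true = refl
... | false = refl

countᵇ-∷-true : ∀ {X : Set} (p : X → Bool) x K → p x ≡ true → countᵇ p (x ∷ K) ≡ suc (countᵇ p K)
countᵇ-∷-true p x K px rewrite px = refl

countᵇ-all : ∀ {X : Set} (p : X → Bool) K → (∀ k → k ∈ K → p k ≡ true) → countᵇ p K ≡ length K
countᵇ-all p [] h = refl
countᵇ-all p (k ∷ K) h rewrite countᵇ-∷ p k K | h k (here refl) = cong suc (countᵇ-all p K (λ k′ m → h k′ (there m)))

countᵇ-none : ∀ {X : Set} (p : X → Bool) w → All (λ y → p y ≡ false) w → countᵇ p w ≡ 0
countᵇ-none p [] _ = refl
countᵇ-none p (y ∷ w) (py ∷ pw) rewrite py = countᵇ-none p w pw

countᵇ-mono : ∀ {X : Set} (p q : X → Bool) K → (∀ k → k ∈ K → p k ≡ true → q k ≡ true) → countᵇ p K ≤ countᵇ q K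
countᵇ-mono p q [] h = z≤n
countᵇ-mono p q (k ∷ K) h rewrite countᵇ-∷ p k K | countᵇ-∷ q k K with p k in ep | q k in eq
... | true | true = s≤s (countᵇ-mono p q K (λ k′ m → h k′ (there m)))
... | true | false = ⊥-elim (true≢false (trans (sym (h k (here refl) ep)) eq))
... | false | true = ≤-trans (countᵇ-mono p q K (λ k′ m → h k′ (there m))) (n≤1+n _)
... | false | false = countᵇ-mono p q K (λ k′ m → h k′ (there m))

countᵇ-mono-< : ∀ {X : Set} (p q : X → Bool) K a → a ∈ K → p a ≡ false → q a ≡ true →
  (∀ k → k ∈ K → p k ≡ true → q k ≡ true) → countᵇ p K < countᵇ q K
countᵇ-mono-< p q (k ∷ K) a (here refl) pa qa h rewrite countᵇ-∷ p a K | countᵇ-∷ q a K | pa | qa =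
  s≤s (countᵇ-mono p q K (λ k′ m → h k′ (there m)))
countᵇ-mono-< p q (k ∷ K) a (there am) pa qa h rewrite countᵇ-∷ p k K | countᵇ-∷ q k K with p k in ep | q k in eq
... | true | true = s≤s (countᵇ-mono-< p q K a am pa qa (λ k′ m → h k′ (there m)))
... | true | false = ⊥-elim (true≢false (trans (sym (h k (here refl) ep)) eq))
... | false | true = ≤-trans (countᵇ-mono-< p q K a am pa qa (λ k′ m → h k′ (there m))) (n≤1+n _)
... | false | false = countᵇ-mono-< p q K a am pa qa (λ k′ m → h k′ (there m))

countᵇ-cong : ∀ {X : Set} (p q : X → Bool) K → (∀ k → k ∈ K → p k ≡ q k) → countᵇ p K ≡ countᵇ q K
countᵇ-cong p q K h =
  ≤-antisym (countᵇ-mono p q K (λ k m e → trans (sym (h k m)) e)) (countᵇ-mono q p K (λ k m e → trans (h k m) e))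

countᵇ-↭ : ∀ {X : Set} (p : X → Bool) {K K′} → K ↭ K′ → countᵇ p K ≡ countᵇ p K′
countᵇ-↭ p e = ↭-length (filter-↭ _ e)

countᵇ-map : ∀ {X Y : Set} (p : Y → Bool) (f : X → Y) K → countᵇ p (map f K) ≡ countᵇ (λ x → p (f x)) K
countᵇ-map p f [] = refl
countᵇ-map p f (k ∷ K) rewrite countᵇ-∷ p (f k) (map f K) | countᵇ-∷ (λ x → p (f x)) k K with p (f k)
... | true = cong suc (countᵇ-map p f K)
... | false = countᵇ-map p f K

countᵇ-++ : ∀ {X : Set} (p : X → Bool) K L → countᵇ p (K ++ L) ≡ countᵇ p K + countᵇ p L
countᵇ-++ p [] L = refl
countᵇ-++ p (k ∷ K) L rewrite countᵇ-∷ p k (K ++ L) | countᵇ-∷ p k K with p k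
... | true = cong suc (countᵇ-++ p K L)
... | false = countᵇ-++ p K L

δ : ℕ → ℕ → ℕ
δ x y = if x ≡ᵇ y then 1 else 0

count≡sum-map : ∀ x u → count x u ≡ sum (map (δ x) u)
count≡sum-map x [] = refl
count≡sum-map x (y ∷ u) = cong (_ +_) (count≡sum-map x u)

count-↭ : ∀ x {u u′} → u ↭ u′ → count x u ≡ count x u′
count-↭ x {u} {u′} p =
  trans (count≡sum-map x u) (trans (sum-↭ (map⁺ (δ x) p)) (sym (count≡sum-map x u′)))

count-++ : ∀ x L M → count x (L ++ M) ≡ count x L + count x M
count-++ x [] M = refl
count-++ x (y ∷ L) M = trans (cong (δ x y +_) (count-++ x L M)) (sym (+-assoc (δ x y) _ _))

count-∈ : ∀ x L → x ∈ L → 1 ≤ count x L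
count-∈ x (y ∷ L) (here refl) rewrite ≡⇒≡ᵇ-true {x} refl = s≤s z≤n
count-∈ x (y ∷ L) (there m) = ≤-trans (count-∈ x L m) (m≤n+m _ (δ x y))

count-∉ : ∀ x L → x ∉ L → count x L ≡ 0
count-∉ x [] nm = refl
count-∉ x (y ∷ L) nm rewrite ≢⇒≡ᵇ-false {x} {y} (λ e → nm (here e)) = count-∉ x L (λ m → nm (there m))

count-Unique : ∀ x L → Unique L → count x L ≤ 1
count-Unique x [] u = z≤n
count-Unique x (y ∷ L) (h ∷ u) with x ≡ᵇ y in e
... | true with ≡ᵇ-true⇒≡ {x} {y} e
... | refl = ≤-reflexive (cong suc (count-∉ x L (λ m → All.lookup h m refl)))
count-Unique x (y ∷ L) (h ∷ u) | false = count-Unique x L u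

hasContent-↭ : ∀ α {u u′} → u ↭ u′ → hasContent α u ≡ hasContent α u′
hasContent-↭ α p = cong (λ L → isYes (≡-dec _≟_ L α)) (map-cong (λ m → count-↭ m p) _)

oneTo : ℕ → List ℕ
oneTo n = applyUpTo suc n

oneTo-unique : ∀ n → Unique (oneTo n)
oneTo-unique n = Unique.applyUpTo⁺₁ suc n (λ i<j _ e → <⇒≢ i<j (suc-injective e))

oneTo-∈⁺ : ∀ n v → 1 ≤ v → v ≤ n → v ∈ oneTo n
oneTo-∈⁺ n (suc i) _ le = ∈-applyUpTo⁺ suc le

oneTo-∈⁻ : ∀ n v → v ∈ oneTo n → 1 ≤ v × v ≤ n
oneTo-∈⁻ n v m with ∈-applyUpTo⁻ suc m
... | i , lt , refl = s≤s z≤n , lt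

countᵇ-<ᵇ-oneTo : ∀ n t → t ≤ suc n → countᵇ (_<ᵇ t) (oneTo n) ≡ t ∸ 1
countᵇ-<ᵇ-oneTo zero zero _ = refl
countᵇ-<ᵇ-oneTo zero (suc zero) _ = refl
countᵇ-<ᵇ-oneTo zero (suc (suc t)) (s≤s ())
countᵇ-<ᵇ-oneTo (suc n) t t≤ = begin
    countᵇ (_<ᵇ t) (oneTo (suc n))
  ≡⟨ cong (countᵇ (_<ᵇ t)) (sym (applyUpTo-∷ʳ suc n)) ⟩
    countᵇ (_<ᵇ t) (oneTo n ∷ʳ suc n)
  ≡⟨ countᵇ-++ (_<ᵇ t) (oneTo n) [ suc n ] ⟩
    countᵇ (_<ᵇ t) (oneTo n) + countᵇ (_<ᵇ t) [ suc n ]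
  ≡⟨ last-step (m≤n⇒m<n∨m≡n t≤) ⟩
    t ∸ 1 ∎
  where
  open ≡-Reasoning
  last-step : t < suc (suc n) ⊎ t ≡ suc (suc n) →
              countᵇ (_<ᵇ t) (oneTo n) + countᵇ (_<ᵇ t) [ suc n ] ≡ t ∸ 1
  last-step (inj₁ (s≤s t≤)) rewrite countᵇ-<ᵇ-oneTo n t t≤ | ≤⇒<ᵇ-false {suc n} {t} t≤ = +-identityʳ (t ∸ 1)
  last-step (inj₂ refl) rewrite <⇒<ᵇ-true (n<1+n (suc n)) =
    trans (cong (_+ 1) (trans (countᵇ-all _ (oneTo n) all-below) (length-applyUpTo suc n))) (+-comm n 1)
    where
    all-below : ∀ k → k ∈ oneTo n → (k <ᵇ suc (suc n)) ≡ true
    all-below k k∈ = <⇒<ᵇ-true (s≤s (m≤n⇒m≤1+n (proj₂ (oneTo-∈⁻ n k k∈))))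

IsWord : ℕ → ℕ → List ℕ → Set
IsWord n N w = length w ≡ n × All (_∈ oneTo N) w

allWords-∈⁻ : ∀ n N w → w ∈ allWords n N → IsWord n N w
allWords-∈⁻ zero N w (here refl) = refl , []
allWords-∈⁻ (suc n) N w m with find (∈-concatMap⁻ (λ u → map (_∷ u) (oneTo N)) {xs = allWords n N} m)
... | u , u∈ , w∈ with ∈-map⁻ (_∷ u) w∈
... | a , a∈ , refl = let (len , letters) = allWords-∈⁻ n N u u∈ in cong suc len , a∈ ∷ letters

allWords-∈⁺ : ∀ n N w → IsWord n N w → w ∈ allWords n N
allWords-∈⁺ zero N [] (refl , []) = here refl
allWords-∈⁺ (suc n) N (a ∷ w) (len , a∈ ∷ letters) =
  ∈-concatMap⁺ (λ u → map (_∷ u) (oneTo N))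
    (lose (allWords-∈⁺ n N w (suc-injective len , letters)) (∈-map⁺ (_∷ w) a∈))

allWords-unique : ∀ n N → Unique (allWords n N)
allWords-unique zero N = [] ∷ []
allWords-unique (suc n) N = Unique-concatMap _ (allWords n N) (allWords-unique n N)
  (λ w _ → Unique.map⁺ ∷-injectiveˡ (oneTo-unique N))
  (λ x y z _ _ m₁ m₂ → same-tail x y z m₁ m₂)
  where
  same-tail : ∀ x y z → z ∈ map (_∷ x) (oneTo N) → z ∈ map (_∷ y) (oneTo N) → x ≡ y
  same-tail x y z m₁ m₂ with ∈-map⁻ (_∷ x) m₁ | ∈-map⁻ (_∷ y) m₂
  ... | a , _ , refl | b , _ , refl = refl

insertEverywhere-∈⁻ : ∀ x (q p : List ℕ) → p ∈ insertEverywhere x q → p ↭ x ∷ q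
insertEverywhere-∈⁻ x [] p (here refl) = ↭-refl
insertEverywhere-∈⁻ x (y ∷ ys) p (here refl) = ↭-refl
insertEverywhere-∈⁻ x (y ∷ ys) p (there m) with ∈-map⁻ (y ∷_) m
... | p′ , m′ , refl = ↭-trans (↭-prep y (insertEverywhere-∈⁻ x ys p′ m′)) (↭-swap y x ↭-refl)

insertEverywhere-∈⁺ : ∀ x (l r : List ℕ) → l ++ x ∷ r ∈ insertEverywhere x (l ++ r)
insertEverywhere-∈⁺ x [] [] = here refl
insertEverywhere-∈⁺ x [] (y ∷ r) = here refl
insertEverywhere-∈⁺ x (y ∷ l) r = there (∈-map⁺ (y ∷_) (insertEverywhere-∈⁺ x l r))

perms-∈⁻ : ∀ xs p → p ∈ perms xs → p ↭ xs
perms-∈⁻ [] p (here refl) = ↭-refl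
perms-∈⁻ (x ∷ xs) p m with find (∈-concatMap⁻ (insertEverywhere x) {xs = perms xs} m)
... | q , q∈ , p∈ = ↭-trans (insertEverywhere-∈⁻ x q p p∈) (↭-prep x (perms-∈⁻ xs q q∈))

perms-∈⁺ : ∀ xs p → p ↭ xs → p ∈ perms xs
perms-∈⁺ [] p p↭[] with ↭-empty-inv p↭[]
... | refl = here refl
perms-∈⁺ (x ∷ xs) p p↭ with ∈-∃++ (∈-resp-↭ (↭-sym p↭) (here refl))
... | l , r , refl = ∈-concatMap⁺ (insertEverywhere x)
  (lose (perms-∈⁺ xs (l ++ r) (drop-mid l [] p↭)) (insertEverywhere-∈⁺ x l r))

deleteFirst : ℕ → List ℕ → List ℕ
deleteFirst x [] = []
deleteFirst x (y ∷ ys) with x ≟ y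
... | yes _ = ys
... | no _ = y ∷ deleteFirst x ys

deleteFirst-head : ∀ x q → deleteFirst x (x ∷ q) ≡ q
deleteFirst-head x q with x ≟ x
... | yes _ = refl
... | no x≢x = ⊥-elim (x≢x refl)

deleteFirst-insertEverywhere : ∀ x q p → x ∉ q → p ∈ insertEverywhere x q → deleteFirst x p ≡ q
deleteFirst-insertEverywhere x [] p x∉q (here refl) = deleteFirst-head x []
deleteFirst-insertEverywhere x (y ∷ ys) p x∉q (here refl) = deleteFirst-head x (y ∷ ys)
deleteFirst-insertEverywhere x (y ∷ ys) p x∉q (there m) with ∈-map⁻ (y ∷_) m
... | p′ , m′ , refl with x ≟ y
... | yes refl = ⊥-elim (x∉q (here refl))
... | no _ = cong (y ∷_) (deleteFirst-insertEverywhere x ys p′ (x∉q ∘ there) m′)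

insertEverywhere-unique : ∀ x q → x ∉ q → Unique (insertEverywhere x q)
insertEverywhere-unique x [] x∉q = [] ∷ []
insertEverywhere-unique x (y ∷ ys) x∉q =
  All.tabulate head-new ∷ Unique.map⁺ ∷-injectiveʳ (insertEverywhere-unique x ys (x∉q ∘ there))
  where
  head-new : ∀ {p} → p ∈ map (y ∷_) (insertEverywhere x ys) → x ∷ y ∷ ys ≢ p
  head-new m e with ∈-map⁻ (y ∷_) m
  head-new m refl | p′ , _ , refl = x∉q (here refl)

perms-unique : ∀ xs → Unique xs → Unique (perms xs)
perms-unique [] _ = [] ∷ []
perms-unique (x ∷ xs) u@(_ ∷ uxs) =
  Unique-concatMap (insertEverywhere x) (perms xs) (perms-unique xs uxs)
    (λ q q∈ → insertEverywhere-unique x q (x∉ q q∈))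
    (λ q q′ z q∈ q′∈ m m′ → trans (sym (deleteFirst-insertEverywhere x q z (x∉ q q∈) m))
                                   (deleteFirst-insertEverywhere x q′ z (x∉ q′ q′∈) m′))
  where
  x∉ : ∀ q → q ∈ perms xs → x ∉ q
  x∉ q q∈ x∈q = Unique[x∷xs]⇒x∉xs u (∈-resp-↭ (perms-∈⁻ xs q q∈) x∈q)

take-+-++ : ∀ {A : Set} m k (p : List A) → take (m + k) p ≡ take m p ++ take k (drop m p)
take-+-++ zero k p = refl
take-+-++ (suc m) k [] = sym (take-[] k)
take-+-++ (suc m) k (x ∷ p) = cong (x ∷_) (take-+-++ m k p)

take-length-++ : ∀ {A : Set} (R q : List A) → take (length R) (R ++ q) ≡ R
take-length-++ [] q = refl
take-length-++ (x ∷ R) q = cong (x ∷_) (take-length-++ R q)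

drop-length-++ : ∀ {A : Set} (R q : List A) → drop (length R) (R ++ q) ≡ q
drop-length-++ [] q = refl
drop-length-++ (x ∷ R) q = drop-length-++ R q

concat-fillShape : ∀ la p → length p ≡ sum la → concat (fillShape la p) ≡ p
concat-fillShape la p len = trans (concat-fillShape-take la p) (take-all (sum la) p (≤-reflexive len))
  where
  concat-fillShape-take : ∀ la p → concat (fillShape la p) ≡ take (sum la) p
  concat-fillShape-take [] p = refl
  concat-fillShape-take (r ∷ la) p =
    trans (cong (take r p ++_) (concat-fillShape-take la (drop r p))) (sym (take-+-++ r (sum la) p))

shape-fillShape : ∀ la p → length p ≡ sum la → map length (fillShape la p) ≡ la
shape-fillShape [] p len = refl
shape-fillShape (r ∷ la) p len = cong₂ _∷_ length-row
  (shape-fillShape la (drop r p) (trans (length-drop r p) (trans (cong (_∸ r) len) (m+n∸m≡n r (sum la)))))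
  where
  length-row : length (take r p) ≡ r
  length-row = trans (length-take r p) (m≤n⇒m⊓n≡m (subst (r ≤_) (sym len) (m≤m+n r (sum la))))

fillShape-concat : ∀ la (F : Filling) → map length F ≡ la → fillShape la (concat F) ≡ F
fillShape-concat [] [] _ = refl
fillShape-concat (r ∷ la) (R ∷ F) refl = cong₂ _∷_ (take-length-++ R (concat F))
  (trans (cong (fillShape la) (drop-length-++ R (concat F))) (fillShape-concat la F refl))

length-concat : ∀ (F : Filling) → length (concat F) ≡ sum (map length F)
length-concat [] = refl
length-concat (R ∷ F) = trans (length-++ R) (cong (length R +_) (length-concat F))

shape-map : ∀ (h : ℕ → ℕ) F → map length (map (map h) F) ≡ map length F
shape-map h [] = refl
shape-map h (R ∷ F) = cong₂ _∷_ (length-map h R) (shape-map h F)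

map-fillShape-unique : ∀ la ws → (∀ p → p ∈ ws → length p ≡ sum la) → Unique ws → Unique (map (fillShape la) ws)
map-fillShape-unique la ws lengths u = Unique.map⁻ {f = concat} (subst Unique (sym concat∘fill≡id) u)
  where
  concat∘fill≡id : map concat (map (fillShape la) ws) ≡ ws
  concat∘fill≡id = trans (sym (map-∘ ws))
    (map-id-local (All.tabulate λ {p} p∈ → concat-fillShape la p (lengths p p∈)))

IsSYT : ℕ → List ℕ → Filling → Set
IsSYT n la T = map length T ≡ la × concat T ↭ oneTo n × isStandard T ≡ true

perm-length : ∀ n la p → sum la ≡ n → p ∈ perms (oneTo n) → length p ≡ sum la
perm-length n la p sum-la p∈ = trans (↭-length (perms-∈⁻ (oneTo n) p p∈)) (trans (length-applyUpTo suc n) (sym sum-la))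

sytList-∈⁻ : ∀ n la T → sum la ≡ n → T ∈ sytList n la → IsSYT n la T
sytList-∈⁻ n la T sum-la m with ∈-filterᵇ⁻ (map (fillShape la) (perms (oneTo n))) m
... | T∈ , standard with ∈-map⁻ (fillShape la) T∈
... | p , p∈ , refl = shape-fillShape la p len ,
                      subst (_↭ oneTo n) (sym (concat-fillShape la p len)) (perms-∈⁻ (oneTo n) p p∈) , standard
  where len = perm-length n la p sum-la p∈

sytList-∈⁺ : ∀ n la T → IsSYT n la T → T ∈ sytList n la
sytList-∈⁺ n la T (shape , perm , standard) = ∈-filterᵇ⁺
  (subst (_∈ map (fillShape la) (perms (oneTo n))) (fillShape-concat la T shape)
    (∈-map⁺ (fillShape la) (perms-∈⁺ (oneTo n) (concat T) perm)))
  standard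

sytList-unique : ∀ n la → sum la ≡ n → Unique (sytList n la)
sytList-unique n la sum-la = Unique-filterᵇ isStandard
  (map-fillShape-unique la _ (λ p → perm-length n la p sum-la) (perms-unique (oneTo n) (oneTo-unique n)))

IsWordFilling : ℕ → ℕ → List ℕ → Filling → Set
IsWordFilling n N la S = map length S ≡ la × IsWord n N (concat S)

wordFillings-∈⁻ : ∀ n N la S → sum la ≡ n → S ∈ map (fillShape la) (allWords n N) → IsWordFilling n N la S
wordFillings-∈⁻ n N la S sum-la m with ∈-map⁻ (fillShape la) m
... | u , u∈ , refl = shape-fillShape la u len , subst (IsWord n N) (sym (concat-fillShape la u len)) word
  where
  word = allWords-∈⁻ n N u u∈
  len = trans (proj₁ word) (sym sum-la)

wordFillings-∈⁺ : ∀ n N la S → IsWordFilling n N la S → S ∈ map (fillShape la) (allWords n N)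
wordFillings-∈⁺ n N la S (shape , word) = subst (_∈ map (fillShape la) (allWords n N)) (fillShape-concat la S shape)
  (∈-map⁺ (fillShape la) (allWords-∈⁺ n N (concat S) word))

wordFillings-unique : ∀ n N la → sum la ≡ n → Unique (map (fillShape la) (allWords n N))
wordFillings-unique n N la sum-la = map-fillShape-unique la _
  (λ p p∈ → trans (proj₁ (allWords-∈⁻ n N p p∈)) (sym sum-la)) (allWords-unique n N)

nth : List ℕ → ℕ → Maybe ℕ
nth [] c = nothing
nth (x ∷ R) zero = just x
nth (x ∷ R) (suc c) = nth R c

cell : Filling → ℕ → ℕ → Maybe ℕ
cell [] r c = nothing
cell (R ∷ F) zero c = nth R c
cell (R ∷ F) (suc r) c = cell F r c

Defined : Maybe ℕ → Set
Defined m = Σ ℕ λ y → m ≡ just y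

nth-< : ∀ R c {x} → nth R c ≡ just x → c < length R
nth-< (y ∷ R) zero e = s≤s z≤n
nth-< (y ∷ R) (suc c) e = s≤s (nth-< R c e)

nth-defined : ∀ R c → c < length R → Defined (nth R c)
nth-defined (y ∷ R) zero p = y , refl
nth-defined (y ∷ R) (suc c) (s≤s p) = nth-defined R c p

nth-∈ : ∀ R c {x} → nth R c ≡ just x → x ∈ R
nth-∈ (y ∷ R) zero refl = here refl
nth-∈ (y ∷ R) (suc c) e = there (nth-∈ R c e)

∈-nth : ∀ R {x} → x ∈ R → Σ ℕ λ c → nth R c ≡ just x
∈-nth (y ∷ R) (here refl) = 0 , refl
∈-nth (y ∷ R) (there m) with ∈-nth R m
... | c , e = suc c , e

nth-unique : ∀ R c c′ {x} → Unique R → nth R c ≡ just x → nth R c′ ≡ just x → c ≡ c′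
nth-unique (y ∷ R) zero zero u e1 e2 = refl
nth-unique (y ∷ R) zero (suc c′) (h ∷ u) refl e2 = ⊥-elim (All.lookup h (nth-∈ R c′ e2) refl)
nth-unique (y ∷ R) (suc c) zero (h ∷ u) e1 refl = ⊥-elim (All.lookup h (nth-∈ R c e1) refl)
nth-unique (y ∷ R) (suc c) (suc c′) (h ∷ u) e1 e2 = cong suc (nth-unique R c c′ u e1 e2)

cell-∈ : ∀ F r c {x} → cell F r c ≡ just x → x ∈ concat F
cell-∈ (R ∷ F) zero c e = ∈-++⁺ˡ (nth-∈ R c e)
cell-∈ (R ∷ F) (suc r) c e = ∈-++⁺ʳ R (cell-∈ F r c e)

∈-cell : ∀ F {x} → x ∈ concat F → Σ ℕ λ r → Σ ℕ λ c → cell F r c ≡ just x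
∈-cell (R ∷ F) m with ∈-++⁻ R m
... | inj₁ m′ = let (c , e) = ∈-nth R m′ in 0 , c , e
... | inj₂ m′ = let (r , c , e) = ∈-cell F m′ in suc r , c , e

cell-map : ∀ (h : ℕ → ℕ) F r c → cell (map (map h) F) r c ≡ Maybe.map h (cell F r c)
cell-map h [] r c = refl
cell-map h (R ∷ F) zero c = row R c
  where
  row : ∀ R c → nth (map h R) c ≡ Maybe.map h (nth R c)
  row [] c = refl
  row (x ∷ R) zero = refl
  row (x ∷ R) (suc c) = row R c
cell-map h (R ∷ F) (suc r) c = cell-map h F r c

adjacentAll-get : ∀ rel R c {x y} → adjacentAll rel R ≡ true → nth R c ≡ just x → nth R (suc c) ≡ just y → rel x y ≡ true
adjacentAll-get rel (a ∷ b ∷ R) zero h refl refl = ∧-true⁻ˡ h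
adjacentAll-get rel (a ∷ b ∷ R) (suc c) h e1 e2 = adjacentAll-get rel (b ∷ R) c (∧-true⁻ʳ {rel a b} h) e1 e2

adjacentAll-intro : ∀ rel R → (∀ c {x y} → nth R c ≡ just x → nth R (suc c) ≡ just y → rel x y ≡ true) →
  adjacentAll rel R ≡ true
adjacentAll-intro rel [] h = refl
adjacentAll-intro rel (a ∷ []) h = refl
adjacentAll-intro rel (a ∷ b ∷ R) h = ∧-true⁺ (h 0 refl refl) (adjacentAll-intro rel (b ∷ R) (λ c → h (suc c)))

rowsOK-get : ∀ rel F r c {x y} → rowsOK rel F ≡ true → cell F r c ≡ just x → cell F r (suc c) ≡ just y → rel x y ≡ true
rowsOK-get rel (R ∷ F) zero c h e1 e2 = adjacentAll-get rel R c (∧-true⁻ˡ h) e1 e2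
rowsOK-get rel (R ∷ F) (suc r) c h e1 e2 = rowsOK-get rel F r c (∧-true⁻ʳ {adjacentAll rel R} h) e1 e2

rowsOK-intro : ∀ rel F → (∀ r c {x y} → cell F r c ≡ just x → cell F r (suc c) ≡ just y → rel x y ≡ true) →
  rowsOK rel F ≡ true
rowsOK-intro rel [] h = refl
rowsOK-intro rel (R ∷ F) h = ∧-true⁺ (adjacentAll-intro rel R (h 0)) (rowsOK-intro rel F (λ r → h (suc r)))

zipWith-<ᵇ-get : ∀ R R′ c {x y} → and (zipWith _<ᵇ_ R R′) ≡ true → nth R c ≡ just x → nth R′ c ≡ just y → x < y
zipWith-<ᵇ-get (a ∷ R) (b ∷ R′) zero h refl refl = <ᵇ-true⇒< (∧-true⁻ˡ h)
zipWith-<ᵇ-get (a ∷ R) (b ∷ R′) (suc c) h e1 e2 = zipWith-<ᵇ-get R R′ c (∧-true⁻ʳ {a <ᵇ b} h) e1 e2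

zipWith-<ᵇ-intro : ∀ R R′ → (∀ c {x y} → nth R c ≡ just x → nth R′ c ≡ just y → x < y) →
  and (zipWith _<ᵇ_ R R′) ≡ true
zipWith-<ᵇ-intro [] R′ h = refl
zipWith-<ᵇ-intro (a ∷ R) [] h = refl
zipWith-<ᵇ-intro (a ∷ R) (b ∷ R′) h = ∧-true⁺ (<⇒<ᵇ-true (h 0 refl refl)) (zipWith-<ᵇ-intro R R′ (λ c → h (suc c)))

columnsStrict-get : ∀ F r c {x y} → columnsStrict F ≡ true → cell F r c ≡ just x → cell F (suc r) c ≡ just y → x < y
columnsStrict-get (R ∷ R′ ∷ F) zero c h e1 e2 = zipWith-<ᵇ-get R R′ c (∧-true⁻ˡ h) e1 e2
columnsStrict-get (R ∷ R′ ∷ F) (suc r) c h e1 e2 = columnsStrict-get (R′ ∷ F) r c (∧-true⁻ʳ {and (zipWith _<ᵇ_ R R′)} h) e1 e2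

columnsStrict-intro : ∀ F → (∀ r c {x y} → cell F r c ≡ just x → cell F (suc r) c ≡ just y → x < y) → columnsStrict F ≡ true
columnsStrict-intro [] h = refl
columnsStrict-intro (R ∷ []) h = refl
columnsStrict-intro (R ∷ R′ ∷ F) h = ∧-true⁺ (zipWith-<ᵇ-intro R R′ (h 0)) (columnsStrict-intro (R′ ∷ F) (λ r → h (suc r)))

RowsShrink : Filling → Set
RowsShrink F = Linked (λ a b → b ≤ a) (map length F)

cell-below-defined : ∀ F r c {y} → RowsShrink F → cell F (suc r) c ≡ just y → Defined (cell F r c)
cell-below-defined (R ∷ R′ ∷ F) zero c (le ∷ _) e = nth-defined R c (≤-trans (nth-< R′ c e) le)
cell-below-defined (R ∷ R′ ∷ F) (suc r) c (_ ∷ d) e = cell-below-defined (R′ ∷ F) r c d e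

cell-lower-defined : ∀ F r r′ c {y} → RowsShrink F → r ≤ r′ → cell F r′ c ≡ just y → Defined (cell F r c)
cell-lower-defined F r r′ c shrink r≤r′ e with m≤n⇒m<n∨m≡n r≤r′
... | inj₂ refl = _ , e
... | inj₁ (s≤s {n = r″} r≤r″) =
  let (_ , e′) = cell-below-defined F r″ c shrink e in cell-lower-defined F r r″ c shrink r≤r″ e′

cell-west-defined : ∀ F r c {y} → cell F r (suc c) ≡ just y → Defined (cell F r c)
cell-west-defined (R ∷ F) zero c e = nth-defined R c (<-trans (n<1+n c) (nth-< R (suc c) e))
cell-west-defined (R ∷ F) (suc r) c e = cell-west-defined F r c e

row-increasing : ∀ F r c c′ {x y} → rowsOK _<ᵇ_ F ≡ true →
  cell F r c ≡ just x → cell F r c′ ≡ just y → c < c′ → x < y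
row-increasing F r c (suc c′) rows e₁ e₂ (s≤s c≤c′) with cell-west-defined F r c′ e₂
... | z , e₃ with m≤n⇒m<n∨m≡n c≤c′
... | inj₁ c<c′ = <-trans (row-increasing F r c c′ rows e₁ e₃ c<c′) step
  where step = <ᵇ-true⇒< (rowsOK-get _<ᵇ_ F r c′ rows e₃ e₂)
... | inj₂ refl = <ᵇ-true⇒< (rowsOK-get _<ᵇ_ F r c rows e₁ e₂)

column-increasing : ∀ F r r′ c {x y} → columnsStrict F ≡ true → RowsShrink F →
  cell F r c ≡ just x → cell F r′ c ≡ just y → r < r′ → x < y
column-increasing F r (suc r′) c cols shrink e₁ e₂ (s≤s r≤r′) with cell-below-defined F r′ c shrink e₂
... | z , e₃ with m≤n⇒m<n∨m≡n r≤r′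
... | inj₁ r<r′ = <-trans (column-increasing F r r′ c cols shrink e₁ e₃ r<r′) (columnsStrict-get F r′ c cols e₃ e₂)
... | inj₂ refl = columnsStrict-get F r c cols e₁ e₂

colOf-sound : ∀ x R c → colOf x R ≡ just c → nth R c ≡ just x
colOf-sound x (y ∷ R) c e with x ≡ᵇ y in eq
colOf-sound x (y ∷ R) c refl | true = cong just (sym (≡ᵇ-true⇒≡ eq))
... | false with colOf x R in eq2
colOf-sound x (y ∷ R) c refl | false | just c′ = colOf-sound x R c′ eq2

colOf-nothing : ∀ x R → colOf x R ≡ nothing → x ∉ R
colOf-nothing x (y ∷ R) e x∈ with x ≡ᵇ y in x≡ᵇy | colOf x R in eq
colOf-nothing x (y ∷ R) () x∈ | true | _
colOf-nothing x (y ∷ R) () x∈ | false | just _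
colOf-nothing x (y ∷ R) e (here refl) | false | nothing with trans (sym x≡ᵇy) (≡⇒≡ᵇ-true {x} refl)
... | ()
colOf-nothing x (y ∷ R) e (there x∈R) | false | nothing = colOf-nothing x R eq x∈R

posOf-sound : ∀ x F r c → posOf x F ≡ just (r , c) → cell F r c ≡ just x
posOf-sound x (R ∷ F) r c e with colOf x R in eq
posOf-sound x (R ∷ F) .0 c refl | just .c = colOf-sound x R c eq
... | nothing with posOf x F in eq2
posOf-sound x (R ∷ F) .(suc r′) c refl | nothing | just (r′ , .c) = posOf-sound x F r′ c eq2

cell-injective : ∀ F r c r′ c′ {x} → Unique (concat F) →
  cell F r c ≡ just x → cell F r′ c′ ≡ just x → r ≡ r′ × c ≡ c′
cell-injective (R ∷ F) zero c zero c′ u e1 e2 = refl , nth-unique R c c′ (proj₁ (Unique-++⁻ R (concat F) u)) e1 e2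
cell-injective (R ∷ F) zero c (suc r′) c′ u e1 e2 =
  ⊥-elim (proj₂ (proj₂ (Unique-++⁻ R (concat F) u)) (nth-∈ R c e1) (cell-∈ F r′ c′ e2))
cell-injective (R ∷ F) (suc r) c zero c′ u e1 e2 =
  ⊥-elim (proj₂ (proj₂ (Unique-++⁻ R (concat F) u)) (nth-∈ R c′ e2) (cell-∈ F r c e1))
cell-injective (R ∷ F) (suc r) c (suc r′) c′ u e1 e2
  with cell-injective F r c r′ c′ (proj₁ (proj₂ (Unique-++⁻ R (concat F) u))) e1 e2
... | refl , refl = refl , refl

posOf-defined : ∀ x F r c → cell F r c ≡ just x → Σ (ℕ × ℕ) λ rc → posOf x F ≡ just rc
posOf-defined x (R ∷ F) r c e with colOf x R in eq
... | just c′ = _ , refl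
... | nothing with posOf x F in eq2
... | just (r′ , c′′) = _ , refl
posOf-defined x (R ∷ F) zero c e | nothing | nothing = ⊥-elim (colOf-nothing x R eq (nth-∈ R c e))
posOf-defined x (R ∷ F) (suc r) c e | nothing | nothing with posOf-defined x F r c e
... | _ , e3 with trans (sym eq2) e3
... | ()

posOf-cell : ∀ x F r c → Unique (concat F) → cell F r c ≡ just x → posOf x F ≡ just (r , c)
posOf-cell x F r c u e with posOf-defined x F r c e
... | (r′ , c′) , ep with cell-injective F r c r′ c′ u e (posOf-sound x F r′ c′ ep)
... | refl , refl = ep

Sorted : List ℕ → Set
Sorted = Linked _≤_

Sorted-tail : ∀ {a w} → Sorted (a ∷ w) → Sorted w
Sorted-tail [-] = []
Sorted-tail (_ ∷ s) = s

Sorted⇒adjacentAll : ∀ w → Sorted w → adjacentAll _≤ᵇ_ w ≡ true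
Sorted⇒adjacentAll [] s = refl
Sorted⇒adjacentAll (a ∷ []) s = refl
Sorted⇒adjacentAll (a ∷ b ∷ w) (a≤b ∷ s) = ∧-true⁺ (≤⇒≤ᵇ-true a≤b) (Sorted⇒adjacentAll (b ∷ w) s)

adjacentAll⇒Sorted : ∀ w → adjacentAll _≤ᵇ_ w ≡ true → Sorted w
adjacentAll⇒Sorted [] s = []
adjacentAll⇒Sorted (a ∷ []) s = [-]
adjacentAll⇒Sorted (a ∷ b ∷ w) s = ≤ᵇ-true⇒≤ (∧-true⁻ˡ s) ∷ adjacentAll⇒Sorted (b ∷ w) (∧-true⁻ʳ {a ≤ᵇ b} s)

Sorted-head-≤ : ∀ a w → Sorted (a ∷ w) → All (a ≤_) w
Sorted-head-≤ a [] s = []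
Sorted-head-≤ a (b ∷ w) (a≤b ∷ s) = a≤b ∷ All.map (≤-trans a≤b) (Sorted-head-≤ b w s)

sortℕ : List ℕ → List ℕ
sortℕ = Sort.sort ≤-decTotalOrder

sortℕ-↭ : ∀ u → sortℕ u ↭ u
sortℕ-↭ = Sort.sort-↭ ≤-decTotalOrder

sortℕ-sorted : ∀ u → Sorted (sortℕ u)
sortℕ-sorted = Sort.sort-↗ ≤-decTotalOrder

Sorted-↭-≡ : ∀ {u v} → Sorted u → Sorted v → u ↭ v → u ≡ v
Sorted-↭-≡ su sv p = Pointwise-≡⇒≡ (↗↭↗⇒≋ ≤-totalOrder su sv (↭⇒↭ₛ p))

nthOr0 : List ℕ → ℕ → ℕ
nthOr0 [] k = 0
nthOr0 (x ∷ w) zero = x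
nthOr0 (x ∷ w) (suc k) = nthOr0 w k

-- Letters are numbered from 1; letterAt w 0 = 0 is a junk value.
letterAt : List ℕ → ℕ → ℕ
letterAt w zero = 0
letterAt w (suc k) = nthOr0 w k

applyUpTo-nthOr0 : ∀ w → applyUpTo (nthOr0 w) (length w) ≡ w
applyUpTo-nthOr0 [] = refl
applyUpTo-nthOr0 (x ∷ w) = cong (x ∷_) (applyUpTo-nthOr0 w)

map-letterAt-oneTo : ∀ w n → length w ≡ n → map (letterAt w) (oneTo n) ≡ w
map-letterAt-oneTo w n refl = trans (map-applyUpTo suc (letterAt w) (length w)) (applyUpTo-nthOr0 w)

nthOr0-mono : ∀ w i j → Sorted w → i ≤ j → j < length w → nthOr0 w i ≤ nthOr0 w j
nthOr0-mono (a ∷ w) zero zero s le lt = ≤-refl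
nthOr0-mono (a ∷ b ∷ w) zero (suc j) (ab ∷ s) le (s≤s lt) = ≤-trans ab (nthOr0-mono (b ∷ w) zero j s z≤n lt)
nthOr0-mono (a ∷ w) (suc i) (suc j) s (s≤s le) (s≤s lt) = nthOr0-mono w i j (Sorted-tail s) le lt

letterAt-mono : ∀ w i j → Sorted w → 1 ≤ i → i ≤ j → j ≤ length w → letterAt w i ≤ letterAt w j
letterAt-mono w (suc i) (suc j) s _ (s≤s le) lt = nthOr0-mono w i j s le lt

letterAt-sorted : ∀ w x k → Sorted w →
  countᵇ (_<ᵇ x) w < k → k ≤ countᵇ (_≤ᵇ x) w → letterAt w k ≡ x
letterAt-sorted [] x k _ lo hi = ⊥-elim (<⇒≱ lo hi)
letterAt-sorted (a ∷ w) x k s lo hi with <-cmp a x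
... | tri< a<x _ _ = past-a k (subst (_< k) (countᵇ-∷-true _ a w (<⇒<ᵇ-true a<x)) lo)
                              (subst (k ≤_) (countᵇ-∷-true _ a w (≤⇒≤ᵇ-true (<⇒≤ a<x))) hi)
  where
  past-a : ∀ k → suc (countᵇ (_<ᵇ x) w) < k → k ≤ suc (countᵇ (_≤ᵇ x) w) → letterAt (a ∷ w) k ≡ x
  past-a (suc (suc k)) (s≤s lo) (s≤s hi) = letterAt-sorted w x (suc k) (Sorted-tail s) lo hi
... | tri≈ _ refl _ = at-x k (≤-<-trans z≤n lo) (subst (k ≤_) (countᵇ-∷-true _ a w (≤⇒≤ᵇ-true (≤-refl {a}))) hi)
  where
  none-below : countᵇ (_<ᵇ a) w ≡ 0
  none-below = countᵇ-none _ w (All.map ≤⇒<ᵇ-false (Sorted-head-≤ a w s))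
  at-x : ∀ k → 0 < k → k ≤ suc (countᵇ (_≤ᵇ a) w) → letterAt (a ∷ w) k ≡ a
  at-x (suc zero) _ _ = refl
  at-x (suc (suc k)) _ (s≤s hi) =
    letterAt-sorted w a (suc k) (Sorted-tail s) (subst (_< suc k) (sym none-below) (s≤s z≤n)) hi
... | tri> _ _ x<a = ⊥-elim (n≮0 (<-≤-trans lo (≤-trans hi (≤-reflexive none-at-most))))
  where
  none-at-most : countᵇ (_≤ᵇ x) (a ∷ w) ≡ 0
  none-at-most = countᵇ-none _ (a ∷ w) (All.map (λ a≤y → <⇒≤ᵇ-false (<-≤-trans x<a a≤y)) (≤-refl ∷ Sorted-head-≤ a w s))

-- Ranks and standardisation

Key : Set
Key = ℕ × ℕ

KeyLt : Key → Key → Set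
KeyLt (x , c) (y , d) = x < y ⊎ (x ≡ y × c < d)

keyLtᵇ : Key → Key → Bool
keyLtᵇ (x , c) (y , d) = (x <ᵇ y) ∨ ((x ≡ᵇ y) ∧ (c <ᵇ d))

keyLtᵇ⇒KeyLt : ∀ a b → keyLtᵇ a b ≡ true → KeyLt a b
keyLtᵇ⇒KeyLt (x , c) (y , d) e with x <ᵇ y in eq
... | true = inj₁ (<ᵇ-true⇒< eq)
... | false = inj₂ (≡ᵇ-true⇒≡ (∧-true⁻ˡ e) , <ᵇ-true⇒< (∧-true⁻ʳ {x ≡ᵇ y} e))

KeyLt⇒keyLtᵇ : ∀ a b → KeyLt a b → keyLtᵇ a b ≡ true
KeyLt⇒keyLtᵇ (x , c) (y , d) (inj₁ lt) rewrite <⇒<ᵇ-true lt = refl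
KeyLt⇒keyLtᵇ (x , c) (y , d) (inj₂ (refl , lt)) with x <ᵇ x
... | true = refl
... | false rewrite ≡⇒≡ᵇ-true {x} refl | <⇒<ᵇ-true lt = refl

¬KeyLt⇒keyLtᵇ-false : ∀ a b → ¬ KeyLt a b → keyLtᵇ a b ≡ false
¬KeyLt⇒keyLtᵇ-false a b n with keyLtᵇ a b in eq
... | true = ⊥-elim (n (keyLtᵇ⇒KeyLt a b eq))
... | false = refl

KeyLt-irrefl : ∀ a → ¬ KeyLt a a
KeyLt-irrefl (x , c) (inj₁ lt) = <-irrefl refl lt
KeyLt-irrefl (x , c) (inj₂ (_ , lt)) = <-irrefl refl lt

KeyLt-trans : ∀ a b c → KeyLt a b → KeyLt b c → KeyLt a c
KeyLt-trans a b c (inj₁ p) (inj₁ q) = inj₁ (<-trans p q)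
KeyLt-trans a b c (inj₁ p) (inj₂ (refl , q)) = inj₁ p
KeyLt-trans a b c (inj₂ (refl , p)) (inj₁ q) = inj₁ q
KeyLt-trans a b c (inj₂ (refl , p)) (inj₂ (refl , q)) = inj₂ (refl , <-trans p q)

KeyLt-asym : ∀ a b → KeyLt a b → ¬ KeyLt b a
KeyLt-asym a b p q = KeyLt-irrefl a (KeyLt-trans a b a p q)

KeyLt-trichotomy : ∀ a b → KeyLt a b ⊎ a ≡ b ⊎ KeyLt b a
KeyLt-trichotomy (x , c) (y , d) with <-cmp x y
... | tri< p _ _ = inj₁ (inj₁ p)
... | tri> _ _ p = inj₂ (inj₂ (inj₁ p))
... | tri≈ _ refl _ with <-cmp c d
... | tri< p _ _ = inj₁ (inj₂ (refl , p))
... | tri≈ _ refl _ = inj₂ (inj₁ refl)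
... | tri> _ _ p = inj₂ (inj₂ (inj₂ (refl , p)))

maximumKey : ∀ (k : Key) K → Σ Key λ m → m ∈ k ∷ K × (∀ e → e ∈ k ∷ K → e ≡ m ⊎ KeyLt e m)
maximumKey k [] = k , here refl , λ { e (here refl) → inj₁ refl }
maximumKey k (k′ ∷ K) with maximumKey k′ K
... | m , m∈ , m-max with KeyLt-trichotomy k m
... | inj₁ k<m = m , there m∈ , λ { e (here refl) → inj₂ k<m ; e (there e∈) → m-max e e∈ }
... | inj₂ (inj₁ refl) = m , there m∈ , λ { e (here refl) → inj₁ refl ; e (there e∈) → m-max e e∈ }
... | inj₂ (inj₂ m<k) = k , here refl , λ { e (here refl) → inj₁ refl ; e (there e∈) → below-k e (m-max e e∈) }
  where
  below-k : ∀ e → e ≡ m ⊎ KeyLt e m → e ≡ k ⊎ KeyLt e k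
  below-k e (inj₁ refl) = inj₂ m<k
  below-k e (inj₂ e<m) = inj₂ (KeyLt-trans e m k e<m m<k)

rank : List Key → Key → ℕ
rank K k = suc (countᵇ (λ k′ → keyLtᵇ k′ k) K)

rank-mono : ∀ K a b → a ∈ K → KeyLt a b → rank K a < rank K b
rank-mono K a b am lt = s≤s (countᵇ-mono-< _ _ K a am (¬KeyLt⇒keyLtᵇ-false a a (KeyLt-irrefl a)) (KeyLt⇒keyLtᵇ a b lt)
  (λ k _ e → KeyLt⇒keyLtᵇ k b (KeyLt-trans k a b (keyLtᵇ⇒KeyLt k a e) lt)))

rank-↭ : ∀ {K K′} e → K ↭ K′ → rank K e ≡ rank K′ e
rank-↭ e K↭K′ = cong suc (countᵇ-↭ _ K↭K′)

rank-∷-not-below : ∀ m K e → ¬ KeyLt m e → rank (m ∷ K) e ≡ rank K e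
rank-∷-not-below m K e m≮e rewrite ¬KeyLt⇒keyLtᵇ-false m e m≮e = refl

-- A maximal key gets the largest rank; remove it and recurse.
ranks-↭-oneTo′ : ∀ n K → length K ≡ n → Unique K → map (rank K) K ↭ oneTo n
ranks-↭-oneTo′ zero [] _ _ = ↭-refl
ranks-↭-oneTo′ (suc n) (k ∷ K₀) len u with maximumKey k K₀
... | m , m∈ , m-max with ∈-∃++ m∈
... | l , r , K≡ = begin
    map (rank K) K            ↭⟨ map⁺ (rank K) K↭ ⟩
    map (rank K) (m ∷ K′)     ≡⟨ cong₂ _∷_ rank-m (map-cong-local (All.tabulate (λ {e} → rank-rest e))) ⟩
    suc n ∷ map (rank K′) K′  ↭⟨ ↭-prep (suc n) (ranks-↭-oneTo′ n K′ len′ u′) ⟩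
    suc n ∷ oneTo n           ↭⟨ ∷↭∷ʳ (suc n) (oneTo n) ⟩
    oneTo n ∷ʳ suc n          ≡⟨ applyUpTo-∷ʳ suc n ⟩
    oneTo (suc n)             ∎
  where
  open PermutationReasoning
  K = k ∷ K₀
  K′ = l ++ r
  unique-split = Unique-middle l r m (subst Unique K≡ u)
  u′ = proj₁ unique-split
  K↭ : K ↭ m ∷ K′
  K↭ = subst (_↭ m ∷ K′) (sym K≡) (shift m l r)
  len′ : length K′ ≡ n
  len′ = suc-injective (trans (sym (↭-length K↭)) len)
  below-m : ∀ e → e ∈ K′ → KeyLt e m
  below-m e e∈ with m-max e (∈-resp-↭ (↭-sym K↭) (there e∈))
  ... | inj₁ refl = ⊥-elim (proj₂ unique-split e∈)
  ... | inj₂ e<m = e<m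
  rank-rest : ∀ e → e ∈ K′ → rank K e ≡ rank K′ e
  rank-rest e e∈ = trans (rank-↭ e K↭) (rank-∷-not-below m K′ e (KeyLt-asym e m (below-m e e∈)))
  rank-m : rank K m ≡ suc n
  rank-m = trans (rank-↭ m K↭) (trans (rank-∷-not-below m K′ m (KeyLt-irrefl m))
             (cong suc (trans (countᵇ-all _ K′ (λ e e∈ → KeyLt⇒keyLtᵇ e m (below-m e e∈))) len′)))

ranks-↭-oneTo : ∀ K → Unique K → map (rank K) K ↭ oneTo (length K)
ranks-↭-oneTo K u = ranks-↭-oneTo′ (length K) K refl u

keyRow : ℕ → List ℕ → List Key
keyRow c [] = []
keyRow c (x ∷ R) = (x , c) ∷ keyRow (suc c) R

keys : Filling → List Key
keys F = concat (map (keyRow 0) F)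

keyRow-∈⁻ : ∀ c₀ R y d → (y , d) ∈ keyRow c₀ R → Σ ℕ λ c → d ≡ c₀ + c × nth R c ≡ just y
keyRow-∈⁻ c₀ (x ∷ R) y d (here refl) = 0 , sym (+-identityʳ c₀) , refl
keyRow-∈⁻ c₀ (x ∷ R) y d (there m) with keyRow-∈⁻ (suc c₀) R y d m
... | c , e1 , e2 = suc c , trans e1 (sym (+-suc c₀ c)) , e2

keyRow-∈⁺ : ∀ c₀ R c y → nth R c ≡ just y → (y , c₀ + c) ∈ keyRow c₀ R
keyRow-∈⁺ c₀ (x ∷ R) zero y refl = here (cong (x ,_) (+-identityʳ c₀))
keyRow-∈⁺ c₀ (x ∷ R) (suc c) y e =
  there (subst (λ z → (y , z) ∈ keyRow (suc c₀) R) (sym (+-suc c₀ c)) (keyRow-∈⁺ (suc c₀) R c y e))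

keys-∈⁻ : ∀ F y d → (y , d) ∈ keys F → Σ ℕ λ r → cell F r d ≡ just y
keys-∈⁻ (R ∷ F) y d m with ∈-++⁻ (keyRow 0 R) m
... | inj₁ m1 = let (c , e1 , e2) = keyRow-∈⁻ 0 R y d m1 in 0 , subst (λ z → nth R z ≡ just y) (sym e1) e2
... | inj₂ m2 = let (r , e) = keys-∈⁻ F y d m2 in suc r , e

keys-∈⁺ : ∀ F r d y → cell F r d ≡ just y → (y , d) ∈ keys F
keys-∈⁺ (R ∷ F) zero d y e = ∈-++⁺ˡ (keyRow-∈⁺ 0 R d y e)
keys-∈⁺ (R ∷ F) (suc r) d y e = ∈-++⁺ʳ (keyRow 0 R) (keys-∈⁺ F r d y e)

keyRow-column-≥ : ∀ c₀ R y d → (y , d) ∈ keyRow c₀ R → c₀ ≤ d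
keyRow-column-≥ c₀ R y d m with keyRow-∈⁻ c₀ R y d m
... | c , refl , _ = m≤m+n c₀ c

keyRow-unique : ∀ c₀ R → Unique (keyRow c₀ R)
keyRow-unique c₀ [] = []
keyRow-unique c₀ (x ∷ R) = All.tabulate (λ {k} m e → fresh k m e) ∷ keyRow-unique (suc c₀) R
  where
  fresh : ∀ k → k ∈ keyRow (suc c₀) R → (x , c₀) ≢ k
  fresh (y , d) m refl = <-irrefl refl (keyRow-column-≥ (suc c₀) R y c₀ m)

keys-unique : ∀ F → (∀ r r′ c x → cell F r c ≡ just x → cell F r′ c ≡ just x → r ≡ r′) → Unique (keys F)
keys-unique [] _ = []
keys-unique (R ∷ F) column-distinct =
  Unique.++⁺ (keyRow-unique 0 R)
    (keys-unique F (λ r r′ c x e e′ → suc-injective (column-distinct (suc r) (suc r′) c x e e′)))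
    disjoint
  where
  disjoint : ∀ {k} → ¬ (k ∈ keyRow 0 R × k ∈ keys F)
  disjoint {y , d} (m₁ , m₂) with keyRow-∈⁻ 0 R y d m₁ | keys-∈⁻ F y d m₂
  ... | c , refl , e₁ | r , e₂ with column-distinct 0 (suc r) c y e₁ e₂
  ... | ()

map-proj₁-keys : ∀ F → map proj₁ (keys F) ≡ concat F
map-proj₁-keys [] = refl
map-proj₁-keys (R ∷ F) = trans (map-++ proj₁ (keyRow 0 R) (keys F)) (cong₂ _++_ (row 0 R) (map-proj₁-keys F))
  where
  row : ∀ c₀ R → map proj₁ (keyRow c₀ R) ≡ R
  row c₀ [] = refl
  row c₀ (x ∷ R) = cong (x ∷_) (row (suc c₀) R)

keys-map : ∀ (h : ℕ → ℕ) F → keys (map (map h) F) ≡ map (λ k → (h (proj₁ k) , proj₂ k)) (keys F)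
keys-map h [] = refl
keys-map h (R ∷ F) = trans (cong₂ _++_ (row 0 R) (keys-map h F)) (sym (map-++ _ (keyRow 0 R) (keys F)))
  where
  row : ∀ c₀ R → keyRow c₀ (map h R) ≡ map (λ k → (h (proj₁ k) , proj₂ k)) (keyRow c₀ R)
  row c₀ [] = refl
  row c₀ (x ∷ R) = cong ((h x , c₀) ∷_) (row (suc c₀) R)

length-keys : ∀ F → length (keys F) ≡ length (concat F)
length-keys F = trans (sym (length-map proj₁ (keys F))) (cong length (map-proj₁-keys F))

mapRowWithColumn : (ℕ → ℕ → ℕ) → ℕ → List ℕ → List ℕ
mapRowWithColumn φ c [] = []
mapRowWithColumn φ c (x ∷ R) = φ x c ∷ mapRowWithColumn φ (suc c) R

mapWithColumn : (ℕ → ℕ → ℕ) → Filling → Filling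
mapWithColumn φ F = map (mapRowWithColumn φ 0) F

nth-mapRowWithColumn : ∀ φ c₀ R c → nth (mapRowWithColumn φ c₀ R) c ≡ Maybe.map (λ x → φ x (c₀ + c)) (nth R c)
nth-mapRowWithColumn φ c₀ [] c = refl
nth-mapRowWithColumn φ c₀ (x ∷ R) zero = cong (λ z → just (φ x z)) (sym (+-identityʳ c₀))
nth-mapRowWithColumn φ c₀ (x ∷ R) (suc c) = trans (nth-mapRowWithColumn φ (suc c₀) R c)
  (cong (λ z → Maybe.map (λ x → φ x z) (nth R c)) (sym (+-suc c₀ c)))

cell-mapWithColumn : ∀ φ F r c → cell (mapWithColumn φ F) r c ≡ Maybe.map (λ x → φ x c) (cell F r c)
cell-mapWithColumn φ [] r c = refl
cell-mapWithColumn φ (R ∷ F) zero c = nth-mapRowWithColumn φ 0 R c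
cell-mapWithColumn φ (R ∷ F) (suc r) c = cell-mapWithColumn φ F r c

concat-mapWithColumn : ∀ φ F → concat (mapWithColumn φ F) ≡ map (λ k → φ (proj₁ k) (proj₂ k)) (keys F)
concat-mapWithColumn φ [] = refl
concat-mapWithColumn φ (R ∷ F) = trans (cong₂ _++_ (row 0 R) (concat-mapWithColumn φ F))
  (sym (map-++ (λ k → φ (proj₁ k) (proj₂ k)) (keyRow 0 R) (keys F)))
  where
  row : ∀ c₀ R → mapRowWithColumn φ c₀ R ≡ map (λ k → φ (proj₁ k) (proj₂ k)) (keyRow c₀ R)
  row c₀ [] = refl
  row c₀ (x ∷ R) = cong (φ x c₀ ∷_) (row (suc c₀) R)

mapWithColumn-id : ∀ φ F → (∀ r c x → cell F r c ≡ just x → φ x c ≡ x) → mapWithColumn φ F ≡ F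
mapWithColumn-id φ [] h = refl
mapWithColumn-id φ (R ∷ F) h = cong₂ _∷_ (row 0 R (λ c x e → h 0 c x e)) (mapWithColumn-id φ F (λ r → h (suc r)))
  where
  row : ∀ c₀ R → (∀ c x → nth R c ≡ just x → φ x (c₀ + c) ≡ x) → mapRowWithColumn φ c₀ R ≡ R
  row c₀ [] h′ = refl
  row c₀ (x ∷ R) h′ = cong₂ _∷_ (trans (cong (φ x) (sym (+-identityʳ c₀))) (h′ 0 x refl))
    (row (suc c₀) R (λ c y e → trans (cong (φ y) (sym (+-suc c₀ c))) (h′ (suc c) y e)))

shape-mapWithColumn : ∀ φ F → map length (mapWithColumn φ F) ≡ map length F
shape-mapWithColumn φ [] = refl
shape-mapWithColumn φ (R ∷ F) = cong₂ _∷_ (row 0 R) (shape-mapWithColumn φ F)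
  where
  row : ∀ c₀ R → length (mapRowWithColumn φ c₀ R) ≡ length R
  row c₀ [] = refl
  row c₀ (x ∷ R) = cong suc (row (suc c₀) R)

mapWithColumn-map : ∀ φ (h : ℕ → ℕ) F → mapWithColumn φ (map (map h) F) ≡ mapWithColumn (λ x c → φ (h x) c) F
mapWithColumn-map φ h [] = refl
mapWithColumn-map φ h (R ∷ F) = cong₂ _∷_ (row 0 R) (mapWithColumn-map φ h F)
  where
  row : ∀ c₀ R → mapRowWithColumn φ c₀ (map h R) ≡ mapRowWithColumn (λ x c → φ (h x) c) c₀ R
  row c₀ [] = refl
  row c₀ (x ∷ R) = cong (φ (h x) c₀ ∷_) (row (suc c₀) R)

map-mapWithColumn : ∀ φ (h : ℕ → ℕ) F → map (map h) (mapWithColumn φ F) ≡ mapWithColumn (λ x c → h (φ x c)) F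
map-mapWithColumn φ h [] = refl
map-mapWithColumn φ h (R ∷ F) = cong₂ _∷_ (row 0 R) (map-mapWithColumn φ h F)
  where
  row : ∀ c₀ R → map h (mapRowWithColumn φ c₀ R) ≡ mapRowWithColumn (λ x c → h (φ x c)) c₀ R
  row c₀ [] = refl
  row c₀ (x ∷ R) = cong (h (φ x c₀) ∷_) (row (suc c₀) R)

-- Number the entries 1, 2, … in increasing order, equal entries from west to east.
standardise : Filling → Filling
standardise S = mapWithColumn (λ x c → rank (keys S) (x , c)) S

-- Descents and compatible words

isBelowOrSE : ActCase → Bool
isBelowOrSE belowOrSE = true
isBelowOrSE sameRow = false
isBelowOrSE northwest = false
isBelowOrSE otherPosition = false

-- The descent set of T: the i with π̄ᵢ e_T = -e_T.
Descent : Filling → ℕ → Bool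
Descent T i = isBelowOrSE (actCase i T)

Descent-below : ∀ T i → Descent T i ≡ true → Σ ℕ λ r1 → Σ ℕ λ c1 → Σ ℕ λ r2 → Σ ℕ λ c2 →
  posOf i T ≡ just (r1 , c1) × posOf (suc i) T ≡ just (r2 , c2) × r1 < r2 × c2 ≤ c1
Descent-below T i e with posOf i T in e1 | posOf (suc i) T in e2
... | just (r1 , c1) | just (r2 , c2) with r1 ≡ᵇ r2 | (r1 <ᵇ r2) ∧ (c2 ≤ᵇ c1) in e3
... | false | true = r1 , c1 , r2 , c2 , refl , refl , <ᵇ-true⇒< (∧-true⁻ˡ e3) , ≤ᵇ-true⇒≤ (∧-true⁻ʳ {r1 <ᵇ r2} e3)
Descent-below T i () | just (r1 , c1) | just (r2 , c2) | true | _
Descent-below T i e | just (r1 , c1) | just (r2 , c2) | false | false with (r2 <ᵇ r1) ∧ (c1 <ᵇ c2)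
Descent-below T i () | just (r1 , c1) | just (r2 , c2) | false | false | true
Descent-below T i () | just (r1 , c1) | just (r2 , c2) | false | false | false
Descent-below T i () | just _ | nothing
Descent-below T i () | nothing | _

Descent-true : ∀ T i r1 c1 r2 c2 → posOf i T ≡ just (r1 , c1) → posOf (suc i) T ≡ just (r2 , c2) →
  r1 < r2 → c2 ≤ c1 → Descent T i ≡ true
Descent-true T i r1 c1 r2 c2 e1 e2 lt le rewrite e1 | e2 | ≢⇒≡ᵇ-false (<⇒≢ lt) | <⇒<ᵇ-true lt | ≤⇒≤ᵇ-true le = refl

Descent-false : ∀ T i r1 c1 r2 c2 → posOf i T ≡ just (r1 , c1) → posOf (suc i) T ≡ just (r2 , c2) →
  Descent T i ≡ false → ¬ (r1 < r2 × c2 ≤ c1)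
Descent-false T i r1 c1 r2 c2 e1 e2 e (lt , le) with trans (sym e) (Descent-true T i r1 c1 r2 c2 e1 e2 lt le)
... | ()

record Standard (T : Filling) : Set where
  field
    rows : rowsOK _<ᵇ_ T ≡ true
    cols : columnsStrict T ≡ true
    shrink : RowsShrink T
    distinct : Unique (concat T)

nonDescent⇒column< : ∀ T r c r′ c′ k → Standard T → cell T r c ≡ just k → cell T r′ c′ ≡ just (suc k) →
  ¬ (r < r′ × c′ ≤ c) → c < c′
nonDescent⇒column< T r c r′ c′ k st e1 e2 nb with <-cmp c c′
... | tri< p _ _ = p
... | tri≈ _ refl _ with <-cmp r r′
... | tri< p _ _ = ⊥-elim (nb (p , ≤-refl))
... | tri≈ _ refl _ = ⊥-elim (<-irrefl (just-injective (trans (sym e1) e2)) (n<1+n k))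
... | tri> _ _ p = ⊥-elim (<-asym (n<1+n k) (column-increasing T r′ r c (Standard.cols st) (Standard.shrink st) e2 e1 p))
nonDescent⇒column< T r c r′ c′ k st e1 e2 nb | tri> _ _ c′<c with <-cmp r r′
... | tri< p _ _ = ⊥-elim (nb (p , <⇒≤ c′<c))
... | tri≈ _ refl _ = ⊥-elim (<⇒≱ (row-increasing T r c′ c (Standard.rows st) e2 e1 c′<c) (n≤1+n k))
... | tri> _ _ r′<r with cell-lower-defined T r′ r c (Standard.shrink st) (<⇒≤ r′<r) e1
... | z , ez = ⊥-elim (<⇒≱ (<-trans (row-increasing T r′ c′ c (Standard.rows st) e2 ez c′<c)
                                   (column-increasing T r′ r c (Standard.cols st) (Standard.shrink st) ez e1 r′<r)) (n≤1+n k))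

strictAt-get : ∀ I j w d → strictAt I j w ≡ true → suc d < length w → I (j + d) ≡ true → nthOr0 w d < nthOr0 w (suc d)
strictAt-get I j (a ∷ []) d h (s≤s ()) Id
strictAt-get I j (a ∷ b ∷ w) zero h lt Id rewrite +-identityʳ j | Id = <ᵇ-true⇒< (∧-true⁻ˡ h)
strictAt-get I j (a ∷ b ∷ w) (suc d) h (s≤s lt) Id =
  strictAt-get I (suc j) (b ∷ w) d (∧-true⁻ʳ {if I j then a <ᵇ b else true} h) lt (subst (λ z → I z ≡ true) (+-suc j d) Id)

strictAt-intro : ∀ I j w → (∀ d → suc d < length w → I (j + d) ≡ true → nthOr0 w d < nthOr0 w (suc d)) → strictAt I j w ≡ true
strictAt-intro I j [] h = refl
strictAt-intro I j (a ∷ []) h = refl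
strictAt-intro I j (a ∷ b ∷ w) h = ∧-true⁺ hd
  (strictAt-intro I (suc j) (b ∷ w) (λ d lt Id → h (suc d) (s≤s lt) (subst (λ z → I z ≡ true) (sym (+-suc j d)) Id)))
  where
  hd : (if I j then a <ᵇ b else true) ≡ true
  hd with I j in eq
  ... | true = <⇒<ᵇ-true (h 0 (s≤s (s≤s z≤n)) (trans (cong I (+-identityʳ j)) eq))
  ... | false = refl

cell-of-oneTo : ∀ T n v → concat T ↭ oneTo n → 1 ≤ v → v ≤ n → Σ ℕ λ r → Σ ℕ λ c → cell T r c ≡ just v
cell-of-oneTo T n v p a b = ∈-cell T (∈-resp-↭ (↭-sym p) (oneTo-∈⁺ n v a b))

cell-∈-oneTo : ∀ T n r c v → concat T ↭ oneTo n → cell T r c ≡ just v → 1 ≤ v × v ≤ n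
cell-∈-oneTo T n r c v p e = oneTo-∈⁻ n v (∈-resp-↭ p (cell-∈ T r c e))

record Compatible (n : ℕ) (T : Filling) (w : List ℕ) : Set where
  field
    standard : Standard T
    perm : concat T ↭ oneTo n
    len : length w ≡ n
    sorted : Sorted w
    strict : strictAt (Descent T) 1 w ≡ true

-- i and i+1 get equal letters only if i is not a descent, which puts i+1 strictly east of i.
sameLetter⇒column<-suc : ∀ n T w t r c r′ c′ → Compatible n T w → cell T r c ≡ just t → cell T r′ c′ ≡ just (suc t) →
  letterAt w t ≡ letterAt w (suc t) → c < c′
sameLetter⇒column<-suc n T w zero r c r′ c′ cp e e′ same =
  ⊥-elim (<⇒≱ (proj₁ (cell-∈-oneTo T n r c 0 (Compatible.perm cp) e)) z≤n)
sameLetter⇒column<-suc n T w (suc i) r c r′ c′ cp e e′ same with Descent T (suc i) in descent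
... | true = ⊥-elim (<-irrefl same (strictAt-get (Descent T) 1 w i (Compatible.strict cp) i+1<len descent))
  where
  i+1<len : suc i < length w
  i+1<len = subst (suc (suc i) ≤_) (sym (Compatible.len cp)) (proj₂ (cell-∈-oneTo T n r′ c′ _ (Compatible.perm cp) e′))
... | false = nonDescent⇒column< T r c r′ c′ (suc i) std e e′
  (Descent-false T (suc i) r c r′ c′ (posOf-cell _ T r c (Standard.distinct std) e)
     (posOf-cell _ T r′ c′ (Standard.distinct std) e′) descent)
  where std = Compatible.standard cp

-- If t < t′ get equal letters, so does every entry in between, and each step moves strictly east.
sameLetter⇒column< : ∀ n T w t t′ r c r′ c′ → Compatible n T w → cell T r c ≡ just t → cell T r′ c′ ≡ just t′ →
  t < t′ → letterAt w t ≡ letterAt w t′ → c < c′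
sameLetter⇒column< n T w t (suc t″) r c r′ c′ cp e e′ (s≤s t≤t″) same with m≤n⇒m<n∨m≡n t≤t″
... | inj₂ refl = sameLetter⇒column<-suc n T w t r c r′ c′ cp e e′ same
... | inj₁ t<t″ with cell-of-oneTo T n t″ (Compatible.perm cp) (≤-trans 1≤t t≤t″) (<⇒≤ t″<n)
  where
  1≤t = proj₁ (cell-∈-oneTo T n r c t (Compatible.perm cp) e)
  t″<n = proj₂ (cell-∈-oneTo T n r′ c′ (suc t″) (Compatible.perm cp) e′)
... | r″ , c″ , e″ = <-trans (sameLetter⇒column< n T w t t″ r c r″ c″ cp e e″ t<t″ same-t″)
                             (sameLetter⇒column<-suc n T w t″ r″ c″ r′ c′ cp e″ e′ same-suc)
  where
  bounds = cell-∈-oneTo T n r′ c′ (suc t″) (Compatible.perm cp) e′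
  within : ∀ {k} → k ≤ suc t″ → k ≤ length w
  within k≤ = ≤-trans k≤ (subst (suc t″ ≤_) (sym (Compatible.len cp)) (proj₂ bounds))
  mono : ∀ {i j} → 1 ≤ i → i ≤ j → j ≤ suc t″ → letterAt w i ≤ letterAt w j
  mono 1≤i i≤j j≤ = letterAt-mono w _ _ (Compatible.sorted cp) 1≤i i≤j (within j≤)
  1≤t = proj₁ (cell-∈-oneTo T n r c t (Compatible.perm cp) e)
  t-≤-t″ = mono 1≤t t≤t″ (n≤1+n t″)
  t″-≤-suc = mono (≤-trans 1≤t t≤t″) (n≤1+n t″) ≤-refl
  same-t″ : letterAt w t ≡ letterAt w t″
  same-t″ = ≤-antisym t-≤-t″ (subst (letterAt w t″ ≤_) (sym same) t″-≤-suc)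
  same-suc : letterAt w t″ ≡ letterAt w (suc t″)
  same-suc = trans (sym same-t″) same

-- Fundamental expansion of Schur functions

module FundamentalExpansion (n : ℕ) (la α : List ℕ) (sum-la : sum la ≡ n)
                            (decreasing : Linked (λ a b → b ≤ a) la) where

  N = length α

  pairs : List (Filling × List ℕ)
  pairs = cartesianProduct (sytList n la) (allWords n N)

  fillings : List Filling
  fillings = map (fillShape la) (allWords n N)

  isCompatiblePair : Filling × List ℕ → Bool
  isCompatiblePair (T , w) = adjacentAll _≤ᵇ_ w ∧ strictAt (Descent T) 1 w ∧ hasContent α w

  isSSYT : Filling → Bool
  isSSYT S = isSemistandard S ∧ hasContent α (concat S)

  relabel : Filling × List ℕ → Filling
  relabel (T , w) = map (map (letterAt w)) T

  standardPair : Filling → Filling × List ℕ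
  standardPair S = standardise S , sortℕ (concat S)

  rowsShrink : ∀ F → map length F ≡ la → RowsShrink F
  rowsShrink F e = subst (Linked (λ a b → b ≤ a)) (sym e) decreasing

  IsSYT⇒Standard : ∀ T → IsSYT n la T → Standard T
  IsSYT⇒Standard T (shape , perm , standard) = record
    { rows = ∧-true⁻ˡ standard ; cols = ∧-true⁻ʳ {rowsOK _<ᵇ_ T} standard
    ; shrink = rowsShrink T shape ; distinct = Unique-resp-↭ perm (oneTo-unique n) }

  IsWord-↭ : ∀ {u v} → u ↭ v → IsWord n N v → IsWord n N u
  IsWord-↭ p (len , letters) = trans (↭-length p) len , All.tabulate (λ m → All.lookup letters (∈-resp-↭ p m))

  module _ (T : Filling) (w : List ℕ) (cp : Compatible n T w) where
    private h = letterAt w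

    relabel-KeyLt : ∀ y t r c r′ d → cell T r c ≡ just t → cell T r′ d ≡ just y → y < t → KeyLt (h y , d) (h t , c)
    relabel-KeyLt y t r c r′ d e e′ y<t with m≤n⇒m<n∨m≡n
      (letterAt-mono w y t (Compatible.sorted cp) (proj₁ (cell-∈-oneTo T n r′ d y (Compatible.perm cp) e′)) (<⇒≤ y<t)
         (subst (t ≤_) (sym (Compatible.len cp)) (proj₂ (cell-∈-oneTo T n r c t (Compatible.perm cp) e))))
    ... | inj₁ hy<ht = inj₁ hy<ht
    ... | inj₂ hy≡ht = inj₂ (hy≡ht , sameLetter⇒column< n T w y t r′ d r c cp e′ e y<t hy≡ht)

    relabel-keyLtᵇ : ∀ y t r c r′ d → cell T r c ≡ just t → cell T r′ d ≡ just y → keyLtᵇ (h y , d) (h t , c) ≡ (y <ᵇ t)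
    relabel-keyLtᵇ y t r c r′ d e e′ with <-cmp y t
    ... | tri< y<t _ _ = trans (KeyLt⇒keyLtᵇ _ _ (relabel-KeyLt y t r c r′ d e e′ y<t)) (sym (<⇒<ᵇ-true y<t))
    ... | tri≈ _ refl _ with cell-injective T r c r′ d (Standard.distinct (Compatible.standard cp)) e e′
    ... | refl , refl = trans (¬KeyLt⇒keyLtᵇ-false _ _ (KeyLt-irrefl (h y , c))) (sym (≤⇒<ᵇ-false (≤-refl {y})))
    relabel-keyLtᵇ y t r c r′ d e e′ | tri> _ _ t<y =
      trans (¬KeyLt⇒keyLtᵇ-false _ _ (KeyLt-asym _ _ (relabel-KeyLt t y r′ d r c e′ e t<y))) (sym (≤⇒<ᵇ-false (<⇒≤ t<y)))

    rank-relabel : ∀ r c t → cell T r c ≡ just t → rank (keys (map (map h) T)) (h t , c) ≡ t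
    rank-relabel r c t e = begin
        suc (countᵇ (λ k → keyLtᵇ k (h t , c)) (keys (map (map h) T)))
      ≡⟨ cong (λ K → suc (countᵇ (λ k → keyLtᵇ k (h t , c)) K)) (keys-map h T) ⟩
        suc (countᵇ (λ k → keyLtᵇ k (h t , c)) (map (λ k → (h (proj₁ k) , proj₂ k)) (keys T)))
      ≡⟨ cong suc (countᵇ-map _ _ (keys T)) ⟩
        suc (countᵇ (λ k → keyLtᵇ (h (proj₁ k) , proj₂ k) (h t , c)) (keys T))
      ≡⟨ cong suc (countᵇ-cong _ _ (keys T) (λ { (y , d) m →
           let (r′ , e′) = keys-∈⁻ T y d m in relabel-keyLtᵇ y t r c r′ d e e′ })) ⟩
        suc (countᵇ (λ k → proj₁ k <ᵇ t) (keys T))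
      ≡⟨ cong suc (sym (countᵇ-map (_<ᵇ t) proj₁ (keys T))) ⟩
        suc (countᵇ (_<ᵇ t) (map proj₁ (keys T)))
      ≡⟨ cong (λ L → suc (countᵇ (_<ᵇ t) L)) (map-proj₁-keys T) ⟩
        suc (countᵇ (_<ᵇ t) (concat T))
      ≡⟨ cong suc (countᵇ-↭ _ (Compatible.perm cp)) ⟩
        suc (countᵇ (_<ᵇ t) (oneTo n))
      ≡⟨ cong suc (countᵇ-<ᵇ-oneTo n t (m≤n⇒m≤1+n (proj₂ t∈))) ⟩
        suc (t ∸ 1)
      ≡⟨ m+[n∸m]≡n {1} {t} (proj₁ t∈) ⟩
        t ∎
      where
      open ≡-Reasoning
      t∈ = cell-∈-oneTo T n r c t (Compatible.perm cp) e

    standardise-relabel : standardise (map (map h) T) ≡ T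
    standardise-relabel = trans (mapWithColumn-map _ h T) (mapWithColumn-id _ T rank-relabel)

  relabel-correct : ∀ x → x ∈ pairs → isCompatiblePair x ≡ true →
    relabel x ∈ fillings × isSSYT (relabel x) ≡ true × standardPair (relabel x) ≡ x
  relabel-correct (T , w) x∈ compatible =
    wordFillings-∈⁺ n N la S (trans (shape-map h T) (proj₁ syt) , IsWord-↭ S↭w word) ,
    ∧-true⁺ (∧-true⁺ rows cols)
      (trans (hasContent-↭ α S↭w) (∧-true⁻ʳ {strictAt (Descent T) 1 w} (∧-true⁻ʳ {adjacentAll _≤ᵇ_ w} compatible))) ,
    cong₂ _,_ (standardise-relabel T w cp) (Sorted-↭-≡ (sortℕ-sorted _) sorted (↭-trans (sortℕ-↭ _) S↭w))
    where
    h = letterAt w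
    S = map (map h) T
    syt = sytList-∈⁻ n la T sum-la (proj₁ (∈-cartesianProduct⁻ (sytList n la) (allWords n N) x∈))
    word = allWords-∈⁻ n N w (proj₂ (∈-cartesianProduct⁻ (sytList n la) (allWords n N) x∈))
    sorted = adjacentAll⇒Sorted w (∧-true⁻ˡ compatible)
    std = IsSYT⇒Standard T syt
    cp : Compatible n T w
    cp = record { standard = std ; perm = proj₁ (proj₂ syt) ; len = proj₁ word ; sorted = sorted
                ; strict = ∧-true⁻ˡ (∧-true⁻ʳ {adjacentAll _≤ᵇ_ w} compatible) }
    S↭w : concat S ↭ w
    S↭w = subst (_↭ w) (sym (concat-map T))
            (↭-trans (map⁺ h (proj₁ (proj₂ syt))) (↭-reflexive (map-letterAt-oneTo w n (proj₁ word))))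
    mono : ∀ {r c r′ c′ t t′} → cell T r c ≡ just t → cell T r′ c′ ≡ just t′ → t < t′ → h t ≤ h t′
    mono {t = t} {t′} e e′ t<t′ =
      letterAt-mono w t t′ sorted (proj₁ (cell-∈-oneTo T n _ _ t (proj₁ (proj₂ syt)) e)) (<⇒≤ t<t′)
      (subst (t′ ≤_) (sym (proj₁ word)) (proj₂ (cell-∈-oneTo T n _ _ t′ (proj₁ (proj₂ syt)) e′)))
    entry : ∀ r c {a} → cell S r c ≡ just a → Σ ℕ λ t → cell T r c ≡ just t × h t ≡ a
    entry r c e = map-just⁻ h (cell T r c) (trans (sym (cell-map h T r c)) e)
    rows : rowsOK _≤ᵇ_ S ≡ true
    rows = rowsOK-intro _≤ᵇ_ S λ r c e₁ e₂ →
      let (t , et , ha) = entry r c e₁ ; (t′ , et′ , hb) = entry r (suc c) e₂ in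
      subst₂ (λ a b → (a ≤ᵇ b) ≡ true) ha hb
        (≤⇒≤ᵇ-true (mono et et′ (<ᵇ-true⇒< (rowsOK-get _<ᵇ_ T r c (Standard.rows std) et et′))))
    cols : columnsStrict S ≡ true
    cols = columnsStrict-intro S λ r c e₁ e₂ →
      let (t , et , ha) = entry r c e₁ ; (t′ , et′ , hb) = entry (suc r) c e₂
          t<t′ = columnsStrict-get T r c (Standard.cols std) et et′ in
      subst₂ _<_ ha hb (≤∧≢⇒< (mono et et′ t<t′)
        (λ same → <-irrefl refl (sameLetter⇒column< n T w t t′ r c (suc r) c cp et et′ t<t′ same)))

  module _ (S : Filling) (semistandard : isSemistandard S ≡ true) (shape : map length S ≡ la) where
    private
      K = keys S
      φ : ℕ → ℕ → ℕ
      φ x c = rank K (x , c)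
      ws = sortℕ (concat S)
      rowsS = ∧-true⁻ˡ {rowsOK _≤ᵇ_ S} semistandard
      colsS = ∧-true⁻ʳ {rowsOK _≤ᵇ_ S} semistandard
      shrinkS = rowsShrink S shape

    keys-distinct : Unique K
    keys-distinct = keys-unique S column-distinct
      where
      column-distinct : ∀ r r′ c x → cell S r c ≡ just x → cell S r′ c ≡ just x → r ≡ r′
      column-distinct r r′ c x e e′ with <-cmp r r′
      ... | tri< r<r′ _ _ = ⊥-elim (<-irrefl refl (column-increasing S r r′ c colsS shrinkS e e′ r<r′))
      ... | tri≈ _ r≡r′ _ = r≡r′
      ... | tri> _ _ r′<r = ⊥-elim (<-irrefl refl (column-increasing S r′ r c colsS shrinkS e′ e r′<r))

    letterAt-rank : ∀ r c x → cell S r c ≡ just x → letterAt ws (φ x c) ≡ x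
    letterAt-rank r c x e = letterAt-sorted ws x (φ x c) (sortℕ-sorted _) lo hi
      where
      count-ws : ∀ (p : ℕ → Bool) → countᵇ p ws ≡ countᵇ (λ k → p (proj₁ k)) K
      count-ws p = trans (countᵇ-↭ p (sortℕ-↭ _)) (trans (cong (countᵇ p) (sym (map-proj₁-keys S))) (countᵇ-map p proj₁ K))
      entry-≤ : ∀ k → KeyLt k (x , c) → proj₁ k ≤ x
      entry-≤ k (inj₁ k<x) = <⇒≤ k<x
      entry-≤ k (inj₂ (k≡x , _)) = ≤-reflexive k≡x
      lo : countᵇ (_<ᵇ x) ws < φ x c
      lo = s≤s (subst (_≤ countᵇ (λ k → keyLtᵇ k (x , c)) K) (sym (count-ws (_<ᵇ x)))
             (countᵇ-mono _ _ K (λ k _ k<x → KeyLt⇒keyLtᵇ k (x , c) (inj₁ (<ᵇ-true⇒< k<x)))))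
      hi : φ x c ≤ countᵇ (_≤ᵇ x) ws
      hi = subst (φ x c ≤_) (sym (count-ws (_≤ᵇ x)))
             (countᵇ-mono-< _ _ K (x , c) (keys-∈⁺ S r c x e) (¬KeyLt⇒keyLtᵇ-false _ _ (KeyLt-irrefl (x , c)))
               (≤⇒≤ᵇ-true (≤-refl {x})) (λ k _ k<x → ≤⇒≤ᵇ-true (entry-≤ k (keyLtᵇ⇒KeyLt k (x , c) k<x))))

    standardise-entry : ∀ r c a → cell (standardise S) r c ≡ just a → Σ ℕ λ x → cell S r c ≡ just x × φ x c ≡ a
    standardise-entry r c a e = map-just⁻ (λ x → φ x c) (cell S r c) (trans (sym (cell-mapWithColumn φ S r c)) e)

    standardise-standard : isStandard (standardise S) ≡ true
    standardise-standard = ∧-true⁺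
      (rowsOK-intro _<ᵇ_ (standardise S) λ r c {a} {b} e₁ e₂ →
        let (x , ex , ha) = standardise-entry r c a e₁
            (y , ey , hb) = standardise-entry r (suc c) b e₂
        in subst₂ (λ a b → (a <ᵇ b) ≡ true) ha hb (<⇒<ᵇ-true (rank-mono K (x , c) (y , suc c) (keys-∈⁺ S r c x ex)
             (east (m≤n⇒m<n∨m≡n (≤ᵇ-true⇒≤ (rowsOK-get _≤ᵇ_ S r c rowsS ex ey)))))))
      (columnsStrict-intro (standardise S) λ r c {a} {b} e₁ e₂ →
        let (x , ex , ha) = standardise-entry r c a e₁
            (y , ey , hb) = standardise-entry (suc r) c b e₂
        in subst₂ _<_ ha hb (rank-mono K (x , c) (y , c) (keys-∈⁺ S r c x ex) (inj₁ (columnsStrict-get S r c colsS ex ey))))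
      where
      east : ∀ {x y c} → x < y ⊎ x ≡ y → KeyLt (x , c) (y , suc c)
      east (inj₁ x<y) = inj₁ x<y
      east (inj₂ x≡y) = inj₂ (x≡y , n<1+n _)

    -- At a descent of standardise S, the entry i+1 lies weakly west of i in a higher row, so its
    -- letter cannot be equal (that would make it east) nor smaller (that would give it a smaller rank).
    sortedContent-strict : strictAt (Descent (standardise S)) 1 ws ≡ true
    sortedContent-strict = strictAt-intro (Descent (standardise S)) 1 ws λ i _ descent →
      let (r₁ , c₁ , r₂ , c₂ , e₁ , e₂ , r₁<r₂ , c₂≤c₁) = Descent-below (standardise S) (suc i) descent
          (x , ex , hx) = standardise-entry r₁ c₁ (suc i) (posOf-sound (suc i) (standardise S) r₁ c₁ e₁)
          (y , ey , hy) = standardise-entry r₂ c₂ (suc (suc i)) (posOf-sound (suc (suc i)) (standardise S) r₂ c₂ e₂)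
      in subst₂ _<_ (sym (trans (cong (letterAt ws) (sym hx)) (letterAt-rank r₁ c₁ x ex)))
                    (sym (trans (cong (letterAt ws) (sym hy)) (letterAt-rank r₂ c₂ y ey)))
                    (letters-< i x y c₁ c₂ r₁ r₂ ex ey r₁<r₂ c₂≤c₁ hx hy)
      where
      letters-< : ∀ i x y c₁ c₂ r₁ r₂ → cell S r₁ c₁ ≡ just x → cell S r₂ c₂ ≡ just y → r₁ < r₂ → c₂ ≤ c₁ →
                  φ x c₁ ≡ suc i → φ y c₂ ≡ suc (suc i) → x < y
      letters-< i x y c₁ c₂ r₁ r₂ ex ey r₁<r₂ c₂≤c₁ hx hy with KeyLt-trichotomy (x , c₁) (y , c₂)
      ... | inj₁ (inj₁ x<y) = x<y
      ... | inj₁ (inj₂ (_ , c₁<c₂)) = ⊥-elim (<⇒≱ c₁<c₂ c₂≤c₁)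
      ... | inj₂ (inj₁ refl) = ⊥-elim (<-irrefl refl (column-increasing S r₁ r₂ c₁ colsS shrinkS ex ey r₁<r₂))
      ... | inj₂ (inj₂ y<x) = ⊥-elim (<⇒≱ (n<1+n (suc i)) (<⇒≤
            (subst₂ _<_ hy hx (rank-mono K (y , c₂) (x , c₁) (keys-∈⁺ S r₂ c₂ y ey) y<x))))

    relabel-standardise : map (map (letterAt ws)) (standardise S) ≡ S
    relabel-standardise = trans (map-mapWithColumn φ (letterAt ws) S) (mapWithColumn-id _ S letterAt-rank)

    standardise-perm : concat (standardise S) ↭ oneTo n
    standardise-perm = subst (_↭ oneTo n) (sym (concat-mapWithColumn φ S))
      (subst (λ m → map (rank K) K ↭ oneTo m) length-K (ranks-↭-oneTo K keys-distinct))
      where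
      length-K : length K ≡ n
      length-K = trans (length-keys S) (trans (length-concat S) (trans (cong sum shape) sum-la))

  standardPair-correct : ∀ S → S ∈ fillings → isSSYT S ≡ true →
    standardPair S ∈ pairs × isCompatiblePair (standardPair S) ≡ true × relabel (standardPair S) ≡ S
  standardPair-correct S S∈ ssyt =
    ∈-cartesianProduct⁺ (sytList-∈⁺ n la (standardise S)
                           (trans (shape-mapWithColumn _ S) shape , standardise-perm S semistandard shape ,
                            standardise-standard S semistandard shape))
                        (allWords-∈⁺ n N _ (IsWord-↭ (sortℕ-↭ _) word)) ,
    ∧-true⁺ (Sorted⇒adjacentAll _ (sortℕ-sorted _))
      (∧-true⁺ (sortedContent-strict S semistandard shape)
               (trans (hasContent-↭ α (sortℕ-↭ _)) (∧-true⁻ʳ {isSemistandard S} ssyt))) ,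
    relabel-standardise S semistandard shape
    where
    shape = proj₁ (wordFillings-∈⁻ n N la S sum-la S∈)
    word = proj₂ (wordFillings-∈⁻ n N la S sum-la S∈)
    semistandard = ∧-true⁻ˡ {isSemistandard S} ssyt

  sum-coefF≡countᵇ-pairs : ∀ (L : List Filling) →
    sum (map (λ T → coefF n (Descent T) α) L) ≡ countᵇ isCompatiblePair (cartesianProduct L (allWords n N))
  sum-coefF≡countᵇ-pairs [] = refl
  sum-coefF≡countᵇ-pairs (T ∷ L) = sym (trans (countᵇ-++ isCompatiblePair (map (T ,_) (allWords n N)) _)
     (cong₂ _+_ (countᵇ-map isCompatiblePair (T ,_) (allWords n N)) (sym (sum-coefF≡countᵇ-pairs L))))

  sum-coefF-Descent : sum (map (λ T → coefF n (Descent T) α) (sytList n la)) ≡ coefSchur la α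
  sum-coefF-Descent = begin
      sum (map (λ T → coefF n (Descent T) α) (sytList n la))
    ≡⟨ sum-coefF≡countᵇ-pairs (sytList n la) ⟩
      countᵇ isCompatiblePair pairs
    ≡⟨ length-filterᵇ-bijection pairs fillings isCompatiblePair isSSYT relabel standardPair
         (Unique.cartesianProduct⁺ (sytList-unique n la sum-la) (allWords-unique n N))
         (wordFillings-unique n N la sum-la) relabel-correct standardPair-correct ⟩
      countᵇ isSSYT fillings
    ≡⟨ cong (λ m → countᵇ isSSYT (map (fillShape la) (allWords m N))) (sym sum-la) ⟩
      coefSchur la α ∎
    where open ≡-Reasoning

-- Row weight

swapLetter : ℕ → ℕ → ℕ
swapLetter i x = if x ≡ᵇ i then suc i else (if x ≡ᵇ suc i then i else x)

swapEntries-map : ∀ i F → swapEntries i F ≡ map (map (swapLetter i)) F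
swapEntries-map i [] = refl
swapEntries-map i ([] ∷ F) = cong ([] ∷_) (swapEntries-map i F)
swapEntries-map i ((x ∷ R) ∷ F) with ∷-injective (swapEntries-map i (R ∷ F))
... | e1 , e2 = cong₂ _∷_ (cong (swapLetter i x ∷_) e1) e2

swapLetter-weight : ∀ i y → swapLetter i y + δ (suc i) y ≡ y + δ i y
swapLetter-weight i y with y ≡ᵇ i in e1
... | true with ≡ᵇ-true⇒≡ {y} {i} e1
... | refl rewrite ≢⇒≡ᵇ-false {suc i} {i} (λ e → <-irrefl (sym e) (n<1+n i)) | ≡⇒≡ᵇ-true {i} refl =
  trans (+-identityʳ (suc i)) (+-comm 1 i)
swapLetter-weight i y | false with y ≡ᵇ suc i in e2
... | true with ≡ᵇ-true⇒≡ {y} {suc i} e2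
... | refl rewrite ≡⇒≡ᵇ-true {suc i} refl | ≢⇒≡ᵇ-false {i} {suc i} (λ e → <-irrefl e (n<1+n i)) =
  trans (+-comm i 1) (sym (+-identityʳ (suc i)))
swapLetter-weight i y | false | false rewrite ≢⇒≡ᵇ-false {suc i} {y} (λ e → true≢false (trans (sym (≡⇒≡ᵇ-true (sym e))) e2))
                  | ≢⇒≡ᵇ-false {i} {y} (λ e → true≢false (trans (sym (≡⇒≡ᵇ-true (sym e))) e1)) = refl

sum-swapLetter : ∀ i L → sum (map (swapLetter i) L) + count (suc i) L ≡ sum L + count i L
sum-swapLetter i [] = refl
sum-swapLetter i (y ∷ L) = begin
    (swapLetter i y + sum (map (swapLetter i) L)) + (δ (suc i) y + count (suc i) L)
  ≡⟨ interchange (swapLetter i y) _ _ _ ⟩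
    (swapLetter i y + δ (suc i) y) + (sum (map (swapLetter i) L) + count (suc i) L)
  ≡⟨ cong₂ _+_ (swapLetter-weight i y) (sum-swapLetter i L) ⟩
    (y + δ i y) + (sum L + count i L)
  ≡⟨ interchange y _ _ _ ⟩
    (y + sum L) + (δ i y + count i L) ∎
  where open ≡-Reasoning

-- Σ over entries x of x · (row of x), and Σ over occurrences of x of the row index.
rowWeight : Filling → ℕ
rowWeight [] = 0
rowWeight (R ∷ F) = rowWeight F + sum (concat F)

rowIndexSum : ℕ → Filling → ℕ
rowIndexSum x [] = 0
rowIndexSum x (R ∷ F) = rowIndexSum x F + count x (concat F)

rowWeight-swap : ∀ i F → rowWeight (map (map (swapLetter i)) F) + rowIndexSum (suc i) F ≡ rowWeight F + rowIndexSum i F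
rowWeight-swap i [] = refl
rowWeight-swap i (R ∷ F) = begin
    (rowWeight (map (map (swapLetter i)) F) + sum (concat (map (map (swapLetter i)) F))) + (rowIndexSum (suc i) F + count (suc i) (concat F))
  ≡⟨ cong (λ z → (rowWeight (map (map (swapLetter i)) F) + sum z) + (rowIndexSum (suc i) F + count (suc i) (concat F))) (concat-map F) ⟩
    (rowWeight (map (map (swapLetter i)) F) + sum (map (swapLetter i) (concat F))) + (rowIndexSum (suc i) F + count (suc i) (concat F))
  ≡⟨ interchange (rowWeight (map (map (swapLetter i)) F)) _ _ _ ⟩
    (rowWeight (map (map (swapLetter i)) F) + rowIndexSum (suc i) F) + (sum (map (swapLetter i) (concat F)) + count (suc i) (concat F))
  ≡⟨ cong₂ _+_ (rowWeight-swap i F) (sum-swapLetter i (concat F)) ⟩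
    (rowWeight F + rowIndexSum i F) + (sum (concat F) + count i (concat F))
  ≡⟨ interchange (rowWeight F) _ _ _ ⟩
    (rowWeight F + sum (concat F)) + (rowIndexSum i F + count i (concat F)) ∎
  where open ≡-Reasoning

rowIndexSum-absent : ∀ x F → count x (concat F) ≡ 0 → rowIndexSum x F ≡ 0
rowIndexSum-absent x [] e = refl
rowIndexSum-absent x (R ∷ F) e = cong₂ _+_ (rowIndexSum-absent x F absent) absent
  where absent = m+n≡0⇒n≡0 (count x R) (trans (sym (count-++ x R (concat F))) e)

rowIndexSum-posOf : ∀ x F r c → count x (concat F) ≤ 1 → posOf x F ≡ just (r , c) → rowIndexSum x F ≡ r
rowIndexSum-posOf x (R ∷ F) r c le e with colOf x R in eq
rowIndexSum-posOf x (R ∷ F) .0 c le refl | just .c = cong₂ _+_ (rowIndexSum-absent x F absent) absent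
  where
  in-R : 1 ≤ count x R
  in-R = count-∈ x R (nth-∈ R c (colOf-sound x R c eq))
  total : count x R + count x (concat F) ≤ 1
  total = subst (_≤ 1) (count-++ x R (concat F)) le
  absent : count x (concat F) ≡ 0
  absent = n≤0⇒n≡0 (+-cancelˡ-≤ 1 _ _ (≤-trans (+-monoˡ-≤ (count x (concat F)) in-R) total))
... | nothing with posOf x F in eq2
rowIndexSum-posOf x (R ∷ F) .(suc r′) c le refl | nothing | just (r′ , .c) =
  trans (cong₂ _+_ (rowIndexSum-posOf x F r′ c at-most-once eq2) (≤-antisym at-most-once present)) (+-comm r′ 1)
  where
  at-most-once : count x (concat F) ≤ 1
  at-most-once = subst (_≤ 1) (trans (count-++ x R (concat F)) (cong (_+ count x (concat F)) (count-∉ x R (colOf-nothing x R eq)))) le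
  present : 1 ≤ count x (concat F)
  present = count-∈ x (concat F) (cell-∈ F r′ c (posOf-sound x F r′ c eq2))

northwest⁻ : ∀ T i → actCase i T ≡ northwest → Σ ℕ λ r1 → Σ ℕ λ c1 → Σ ℕ λ r2 → Σ ℕ λ c2 →
  posOf i T ≡ just (r1 , c1) × posOf (suc i) T ≡ just (r2 , c2) × r2 < r1
northwest⁻ T i e with posOf i T in e1 | posOf (suc i) T in e2
... | just (r1 , c1) | just (r2 , c2) with r1 ≡ᵇ r2 | (r1 <ᵇ r2) ∧ (c2 ≤ᵇ c1) | (r2 <ᵇ r1) ∧ (c1 <ᵇ c2) in e3
... | false | false | true = r1 , c1 , r2 , c2 , refl , refl , <ᵇ-true⇒< (∧-true⁻ˡ e3)
northwest⁻ T i () | just _ | just _ | true | _ | _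
northwest⁻ T i () | just _ | just _ | false | true | _
northwest⁻ T i () | just _ | just _ | false | false | false
northwest⁻ T i () | just _ | nothing
northwest⁻ T i () | nothing | _

-- Moving i down to row r₂ and i+1 up to row r₁ changes the weight by r₁ − r₂ > 0.
rowWeight-northwest : ∀ T i → (∀ x → count x (concat T) ≤ 1) → actCase i T ≡ northwest →
  rowWeight T < rowWeight (swapEntries i T)
rowWeight-northwest T i distinct e with northwest⁻ T i e
... | r₁ , c₁ , r₂ , c₂ , e₁ , e₂ , r₂<r₁ =
  +-cancelʳ-< r₂ _ _ (subst (rowWeight T + r₂ <_) balance (+-monoʳ-< (rowWeight T) r₂<r₁))
  where
  open ≡-Reasoning
  balance : rowWeight T + r₁ ≡ rowWeight (swapEntries i T) + r₂
  balance = sym (begin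
      rowWeight (swapEntries i T) + r₂
    ≡⟨ cong₂ _+_ (cong rowWeight (swapEntries-map i T)) (sym (rowIndexSum-posOf (suc i) T r₂ c₂ (distinct (suc i)) e₂)) ⟩
      rowWeight (map (map (swapLetter i)) T) + rowIndexSum (suc i) T
    ≡⟨ rowWeight-swap i T ⟩
      rowWeight T + rowIndexSum i T
    ≡⟨ cong (rowWeight T +_) (rowIndexSum-posOf i T r₁ c₁ (distinct i) e₁) ⟩
      rowWeight T + r₁ ∎)

-- The composition series

argmax : ∀ {D} (key : Fin (suc D) → ℕ) → Σ[ m ∈ Fin (suc D) ] (∀ j → key j ≤ key m)
argmax {zero} key = Fin.zero , λ { Fin.zero → ≤-refl }
argmax {suc D} key with argmax (λ j → key (Fin.suc j))
... | m , max with ≤-total (key Fin.zero) (key (Fin.suc m))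
... | inj₁ le = Fin.suc m , λ { Fin.zero → le ; (Fin.suc j) → max j }
... | inj₂ ge = Fin.zero , λ { Fin.zero → ≤-refl ; (Fin.suc j) → ≤-trans (max j) ge }

SortedDownBy : ∀ {D} → (Fin D → ℕ) → Permutation′ D → Set
SortedDownBy key π = ∀ j k → key (π ⟨$⟩ʳ k) < key (π ⟨$⟩ʳ j) → toℕ j < toℕ k

sortDownBy : ∀ D (key : Fin D → ℕ) → Σ[ π ∈ Permutation′ D ] SortedDownBy key π
sortDownBy zero key = idₚ , λ ()
sortDownBy (suc D) key with argmax key
... | m , max with sortDownBy D (λ k → key (Fin.punchIn m k))
... | π , sorted = insert Fin.zero m π , ordered
  where
  shift-suc : ∀ k → insert Fin.zero m π ⟨$⟩ʳ Fin.suc k ≡ Fin.punchIn m (π ⟨$⟩ʳ k)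
  shift-suc = insert-punchIn Fin.zero m π
  ordered : SortedDownBy key (insert Fin.zero m π)
  ordered Fin.zero Fin.zero lt = ⊥-elim (<-irrefl refl lt)
  ordered Fin.zero (Fin.suc k) lt = s≤s z≤n
  ordered (Fin.suc j) Fin.zero lt = ⊥-elim (<⇒≱ lt (max _))
  ordered (Fin.suc j) (Fin.suc k) lt =
    s≤s (sorted j k (subst₂ (λ a b → key a < key b) (shift-suc k) (shift-suc j) lt))

map-permutation-allFin : ∀ {D} (π : Permutation′ D) → map (π ⟨$⟩ʳ_) (allFin D) ↭ allFin D
map-permutation-allFin {D} π = ∼bag⇒↭ (unique∧set⇒bag
  (Unique.map⁺ (λ {x} {y} e → trans (sym (inverseˡ π)) (trans (cong (π ⟨$⟩ˡ_) e) (inverseˡ π))) (Unique.allFin⁺ D))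
  (Unique.allFin⁺ D)
  (λ {t} → mk⇔ (λ _ → ∈-allFin t) (λ _ → subst (_∈ map (π ⟨$⟩ʳ_) (allFin D)) (inverseʳ π) (∈-map⁺ _ (∈-allFin _)))))

∑-zero : ∀ {D} (f : Fin D → ℚ.ℚ) → (∀ j → f j ≡ ℚ.0ℚ) → ∑ f ≡ ℚ.0ℚ
∑-zero {zero} f h = refl
∑-zero {suc D} f h =
  trans (cong₂ ℚ._+_ (h Fin.zero) (∑-zero (λ j → f (Fin.suc j)) (λ j → h (Fin.suc j)))) (ℚ.+-identityʳ ℚ.0ℚ)

∑-single : ∀ {D} (f : Fin D → ℚ.ℚ) m → (∀ j → j ≢ m → f j ≡ ℚ.0ℚ) → ∑ f ≡ f m
∑-single f Fin.zero h =
  trans (cong (f Fin.zero ℚ.+_) (∑-zero _ (λ j → h (Fin.suc j) (λ ())))) (ℚ.+-identityʳ _)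
∑-single f (Fin.suc m) h =
  trans (cong₂ ℚ._+_ (h Fin.zero (λ ())) (∑-single (λ j → f (Fin.suc j)) m (λ j ne → h (Fin.suc j) (ne ∘ Fin.suc-injective))))
        (ℚ.+-identityˡ _)

module SpechtSeries (n : ℕ) (la : List ℕ) (ip : IsPartition n la) where
  open Specht n la

  sum-la : sum la ≡ n
  sum-la = proj₂ (proj₂ ip)

  basis-≢ : ∀ k j → j ≢ k → basis k j ≡ ℚ.0ℚ
  basis-≢ k j ne with j Fin.≟ k
  ... | yes e = ⊥-elim (ne e)
  ... | no _ = refl

  basis-diag : ∀ k → basis k k ≡ ℚ.1ℚ
  basis-diag k with k Fin.≟ k
  ... | yes _ = refl
  ... | no ne = ⊥-elim (ne refl)

  πact-basis : ∀ i m t → πact i (basis m) t ≡ πbasis i m t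
  πact-basis i m t =
    trans (∑-single _ m (λ k ne → trans (cong (ℚ._* πbasis i k t) (basis-≢ m k ne)) (ℚ.*-zeroˡ (πbasis i k t))))
          (trans (cong (ℚ._* πbasis i m t) (basis-diag m)) (ℚ.*-identityˡ _))

  weight : Fin D → ℕ
  weight j = rowWeight (tab j)

  order : Permutation′ D
  order = proj₁ (sortDownBy D weight)

  σ : Fin D → Fin D
  σ = order ⟨$⟩ʳ_

  v : Fin D → Vec D
  v k = basis (σ k)

  coordinates : ∀ (c : Fin D → ℚ.ℚ) t → ∑ (λ j → c j ℚ.* v j t) ≡ c (order ⟨$⟩ˡ t)
  coordinates c t =
    trans (∑-single _ (order ⟨$⟩ˡ t) off-diagonal)
          (trans (cong (λ z → c (order ⟨$⟩ˡ t) ℚ.* basis z t) (inverseʳ order))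
                 (trans (cong (c (order ⟨$⟩ˡ t) ℚ.*_) (basis-diag t)) (ℚ.*-identityʳ _)))
    where
    off-diagonal : ∀ j → j ≢ order ⟨$⟩ˡ t → c j ℚ.* v j t ≡ ℚ.0ℚ
    off-diagonal j j≢ = trans (cong (c j ℚ.*_) (basis-≢ (σ j) t λ σj≡t →
      j≢ (trans (sym (inverseˡ order)) (cong (order ⟨$⟩ˡ_) (sym σj≡t))))) (ℚ.*-zeroʳ (c j))

  v-isBasis : IsBasis v
  v-isBasis = (λ c h j → trans (cong c (sym (inverseˡ order))) (trans (sym (coordinates c (σ j))) (h (σ j)))) ,
              (λ u → (λ j → u (σ j)) , λ t → sym (trans (coordinates (λ j → u (σ j)) t) (cong u (inverseʳ order))))

  descents : Fin D → ℕ → Bool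
  descents k = Descent (tab (σ k))

  in-span-zero : ∀ k (u : Vec D) → (∀ t → u t ≡ ℚ.0ℚ) → InSpanBelow v k u
  in-span-zero k u h = (λ _ → ℚ.0ℚ) , (λ _ _ → refl) , λ t → trans (h t) (sym (∑-zero _ (λ j → ℚ.*-zeroˡ (v j t))))

  tab-∈ : ∀ m → tab m ∈ sytList n la
  tab-∈ m = ∈-lookup m

  entries-distinct : ∀ m x → count x (concat (tab m)) ≤ 1
  entries-distinct m x = subst (_≤ 1) (sym (count-↭ x (proj₁ (proj₂ (sytList-∈⁻ n la (tab m) sum-la (tab-∈ m))))))
                               (count-Unique x (oneTo n) (oneTo-unique n))

  in-span-resp : ∀ k {u u′ : Vec D} → (∀ t → u t ≡ u′ t) → InSpanBelow v k u′ → InSpanBelow v k u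
  in-span-resp k u≗u′ (c , c-below , u′≡) = c , c-below , λ t → trans (u≗u′ t) (u′≡ t)

  factor-basis : ∀ k i → InSpanBelow v k (λ t → πbasis i (σ k) t ℚ.+ (if descents k i then v k t else ℚ.0ℚ))
  factor-basis k i with actCase i (tab (σ k)) in e
  ... | sameRow = in-span-zero k _ λ t → ℚ.+-identityʳ ℚ.0ℚ
  ... | otherPosition = in-span-zero k _ λ t → ℚ.+-identityʳ ℚ.0ℚ
  ... | belowOrSE = in-span-zero k _ λ t → ℚ.+-inverseˡ (basis (σ k) t)
  -- π̄ᵢ e_T = e_{sᵢT}, and sᵢT has a larger row weight, so it comes earlier in the basis.
  ... | northwest = c , c-below , λ t →
        trans (ℚ.+-identityʳ _) (trans (cong (indicator S) (sym (inverseʳ order))) (sym (coordinates c t)))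
    where
    S = swapEntries i (tab (σ k))
    c : Fin D → ℚ.ℚ
    c j = indicator S (σ j)
    c-below : ∀ j → toℕ k ≤ toℕ j → c j ≡ ℚ.0ℚ
    c-below j le with tab (σ j) ≟F S
    ... | yes σj≡S = ⊥-elim (<⇒≱ (proj₂ (sortDownBy D weight) j k
            (subst (λ T → rowWeight (tab (σ k)) < rowWeight T) (sym σj≡S)
                   (rowWeight-northwest (tab (σ k)) i (entries-distinct (σ k)) e))) le)
    ... | no _ = refl

  factor : ∀ k i → InSpanBelow v k (λ t → πact i (v k) t ℚ.+ (if descents k i then v k t else ℚ.0ℚ))
  factor k i = in-span-resp k (λ t → cong (ℚ._+ (if descents k i then v k t else ℚ.0ℚ)) (πact-basis i (σ k) t)) (factor-basis k i)

  compositionSeries : CompositionSeries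
  compositionSeries = record { v = v ; I = descents ; isBasis = v-isBasis ; factor = λ k i _ _ → factor k i }

  FQchar≡Schur : ∀ α → coefFQchar n la compositionSeries α ≡ coefSchur la α
  FQchar≡Schur α = begin
      sum (map (λ k → coefF n (descents k) α) (allFin D))
    ≡⟨ cong sum (map-∘ (allFin D)) ⟩
      sum (map (λ m → coefF n (Descent (tab m)) α) (map σ (allFin D)))
    ≡⟨ sum-↭ (map⁺ _ (map-permutation-allFin order)) ⟩
      sum (map (λ m → coefF n (Descent (tab m)) α) (allFin D))
    ≡⟨ cong sum (trans (map-∘ (allFin D)) (cong (map _) (trans (map-tabulate (λ x → x) tab) (tabulate-lookup (sytList n la))))) ⟩
      sum (map (λ T → coefF n (Descent T) α) (sytList n la))
    ≡⟨ FundamentalExpansion.sum-coefF-Descent n la α sum-la (proj₁ (proj₂ ip)) ⟩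
      coefSchur la α ∎
    where open ≡-Reasoning

theorem2 : (n : ℕ) (la : List ℕ) → IsPartition n la →
  Σ[ cs ∈ Specht.CompositionSeries n la ]
    ((α : List ℕ) → coefFQchar n la cs α ≡ coefSchur la α)
theorem2 n la ip = compositionSeries , FQchar≡Schur
  where open SpechtSeries n la ip
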